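{- For every $f\in\mathbb N$ there is a constant $C_f$ such that the following holds. Let $m\in\mathbb N$, $\gamma>0$, and let $V$ be a finite set with $2f\le mf\le |V|$. For each $i\in [m]$, let $\mathcal{F}_{i}$ be a collection of at least $\gamma |V|^{f}$ ordered $f$-subsets of $V$, and let $\vec X_{1},\dots,\vec X_{m}$ be uniformly random pairwise disjoint ordered $f$-subsets of $V$. Let $N$ be the number of $i\in[m]$ such that $\vec X_{i}\in\mathcal{F}_{i}$. Then \[ \Pr[N<\gamma m/2]\le\frac{C_f}{\gamma m}. \]
   Context: An ordered $f$-subset of $V$ is a sequence of $f$ distinct elements of $V$. Two ordered $f$-subsets are disjoint if no element of $V$ appears in both. "Uniformly random pairwise disjoint" means $(\vec X_1,\dots,\vec X_m)$ is uniformly distributed over all $m$-tuples of pairwise disjoint ordered $f$-subsets of $V$.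
   Formalization: The parameter γ ranges over the positive rationals, and the constant $C_f$ is taken in ℚ. -}

module Defs where

open import Data.Nat using (ℕ; zero; suc)
open import Data.Fin using (Fin)
open import Data.Fin.Properties using () renaming (_≟_ to _≟ᶠ_)
open import Data.Bool using (Bool; true; false; _≟_)
open import Data.Vec using (Vec; []; _∷_; toList; lookup)
open import Data.List using (List; []; _∷_; map; concatMap; allFin; filter; length)
open import Data.List.Relation.Unary.All using (All; all?)
open import Data.List.Relation.Unary.AllPairs using (AllPairs; allPairs?)
open import Data.List.Relation.Unary.Unique.Propositional using (Unique)
open import Data.List.Membership.Propositional using (_∉_)
import Data.List.Membership.DecPropositional as DecMem
open import Data.Product using (_×_)
open import Relation.Nullary using (Dec; ¬?)
open import Relation.Nullary.Decidable using (_×-dec_)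
open import Relation.Binary.PropositionalEquality using (_≡_)
open import Data.Integer using (+_)
open import Data.Rational using (ℚ; _/_)

-- The vertex set V is modelled as Fin n (|V| = n).

allTuples : ∀ {A : Set} → List A → (f : ℕ) → List (Vec A f)
allTuples xs zero    = [] ∷ []
allTuples xs (suc f) = concatMap (λ x → map (x ∷_) (allTuples xs f)) xs

-- An ordered f-subset of V: a sequence of f distinct elements of V.
IsOrdered : ∀ {n f} → Vec (Fin n) f → Set
IsOrdered v = Unique (toList v)

isOrdered? : ∀ {n f} (v : Vec (Fin n) f) → Dec (IsOrdered v)
isOrdered? v = allPairs? (λ x y → ¬? (x ≟ᶠ y)) (toList v)

ordSubsets : (n f : ℕ) → List (Vec (Fin n) f)
ordSubsets n f = filter isOrdered? (allTuples (allFin n) f)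

DisjointV : ∀ {n f} → Vec (Fin n) f → Vec (Fin n) f → Set
DisjointV u v = All (λ x → x ∉ toList v) (toList u)

disjointV? : ∀ {n f} (u v : Vec (Fin n) f) → Dec (DisjointV u v)
disjointV? {n} u v = all? (λ x → ¬? (x ∈? toList v)) (toList u)
  where open DecMem (_≟ᶠ_ {n}) using (_∈?_)

IsDisjointFamily : ∀ {n f m} → Vec (Vec (Fin n) f) m → Set
IsDisjointFamily xs = All IsOrdered (toList xs) × AllPairs DisjointV (toList xs)

isDisjointFamily? : ∀ {n f m} (xs : Vec (Vec (Fin n) f) m) → Dec (IsDisjointFamily xs)
isDisjointFamily? xs = all? isOrdered? (toList xs) ×-dec allPairs? disjointV? (toList xs)

-- The sample space Ω: all m-tuples of pairwise disjoint ordered f-subsets of Fin n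
-- (the uniform distribution on this list is the law of (X_1,…,X_m)).
Ω : (n f m : ℕ) → List (Vec (Vec (Fin n) f) m)
Ω n f m = filter isDisjointFamily? (allTuples (ordSubsets n f) m)

-- |F_i|: the collection F_i is given by its indicator function on ordered f-subsets.
card : ∀ {n f} → (Vec (Fin n) f → Bool) → ℕ
card {n} {f} F = length (filter (λ v → F v ≟ true) (ordSubsets n f))

countHits : ∀ {n f m} → (Fin m → Vec (Fin n) f → Bool) → Vec (Vec (Fin n) f) m → ℕ
countHits {m = m} F xs = length (filter (λ i → F i (lookup xs i) ≟ true) (allFin m))

ℕ→ℚ : ℕ → ℚ
ℕ→ℚ k = (+ k) / 1

-- Second-moment method. Counting the families that extend one or two prescribed coordinates gives
-- Pr[X i ∈ F i] = |F i| / (n)_f and Pr[X i ∈ F i ∧ X j ∈ F j] = |F i| |F j| / ((n)_f (n − f)_f) for i ≠ j,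
-- with (n)_f the falling factorial; hence 𝔼 N ≥ γ m. Since n ≥ m f, (n)_f / (n − f)_f ≤ 1 + D_f / m, so
-- Var N ≤ (1 + D_f) 𝔼 N, and Chebyshev gives Pr[N < γ m / 2] ≤ Pr[N < 𝔼 N / 2] ≤ 4 (1 + D_f) / (γ m).
-- Everything is proved with denominators cleared, as statements about counts in ℕ.

module Submission where

open import Defs
open import Data.Nat using (ℕ; zero; suc; _+_; _*_; _∸_; _^_; _≤_; _<_; z≤n; s≤s; _≤?_; _≟_; ∣_-_∣; ≢-nonZero)
open import Data.Nat.Properties hiding (_<?_)
open import Data.Nat.Tactic.RingSolver using (solve-∀)
open import Data.Bool using (Bool; true; if_then_else_) renaming (_≟_ to _≟ᵇ_)
open import Data.Fin using (Fin; zero; suc)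
open import Data.Fin.Properties using () renaming (_≟_ to _≟ᶠ_)
open import Data.List using (List; []; _∷_; _++_; map; concatMap; filter; length; allFin)
open import Data.List.Properties using (map-tabulate; length-tabulate; length-++; length-filter)
open import Data.List.Relation.Unary.All using (All; []; _∷_; all?)
import Data.List.Relation.Unary.All as All
open import Data.List.Relation.Unary.All.Properties using (All¬⇒¬Any; ¬Any⇒All¬)
open import Data.List.Relation.Unary.Any using (here; there)
open import Data.List.Relation.Unary.AllPairs using (AllPairs; []; _∷_; allPairs?)
open import Data.List.Relation.Unary.Unique.Propositional using (Unique)
open import Data.List.Membership.Propositional using (_∈_; _∉_)
open import Data.List.Membership.Propositional.Properties using (∈-++⁺ˡ; ∈-++⁺ʳ; ∈-++⁻)
import Data.List.Relation.Unary.Unique.Propositional.Properties as Unique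
import Data.List.Membership.DecPropositional as DecMembership
open import Data.Vec using (Vec; []; _∷_; toList; lookup)
import Data.Vec.Properties as Vec
open import Data.Product using (_×_; _,_; proj₁; proj₂; ∃)
open import Data.Sum using (inj₁; inj₂)
open import Data.Maybe using (Maybe; just; nothing)
open import Data.Unit using (⊤; tt)
open import Function using (_∘_; id)
open import Relation.Nullary using (Dec; yes; no; does; ¬_; ¬?)
open import Relation.Nullary.Decidable using (_×-dec_)
open import Relation.Binary.PropositionalEquality
import Algebra.Properties.CommutativeSemigroup as CommSemigroupProperties
open import Data.Empty using (⊥-elim)
import Data.Integer as ℤ
import Data.Integer.Properties as ℤₚ
import Data.Integer.Tactic.RingSolver as ℤ-Solver
open import Data.Rational using (ℚ; 0ℚ) renaming (_*_ to _*ℚ_; _≤_ to _≤ℚ_; _<_ to _<ℚ_)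
import Data.Rational as ℚ
import Data.Rational.Properties as ℚₚ
open import Data.Rational.Properties using (_<?_)
import Data.Rational.Unnormalised as ℚᵘ
import Data.Rational.Unnormalised.Properties as ℚᵘₚ
open import Data.Nat.Coprimality using (1-coprimeTo) renaming (sym to coprime-sym)

module +-CS = CommSemigroupProperties +-commutativeSemigroup
module *-CS = CommSemigroupProperties *-commutativeSemigroup

private variable
  A B : Set

-- Finite sums and indicators

∑ : List A → (A → ℕ) → ℕ
∑ []       g = 0
∑ (x ∷ xs) g = g x + ∑ xs g

syntax ∑ xs (λ x → e) = ∑[ x ∈ xs ] e

∑-cong : (xs : List A) {g h : A → ℕ} → (∀ x → g x ≡ h x) → ∑ xs g ≡ ∑ xs h
∑-cong []       e = refl
∑-cong (x ∷ xs) e = cong₂ _+_ (e x) (∑-cong xs e)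

∑-mono-≤ : (xs : List A) {g h : A → ℕ} → (∀ x → g x ≤ h x) → ∑ xs g ≤ ∑ xs h
∑-mono-≤ []       e = z≤n
∑-mono-≤ (x ∷ xs) e = +-mono-≤ (e x) (∑-mono-≤ xs e)

∑-const : (xs : List A) (c : ℕ) → ∑[ _ ∈ xs ] c ≡ length xs * c
∑-const []       c = refl
∑-const (x ∷ xs) c = cong (c +_) (∑-const xs c)

∑-+ : (xs : List A) (g h : A → ℕ) → ∑[ x ∈ xs ] (g x + h x) ≡ ∑ xs g + ∑ xs h
∑-+ []       g h = refl
∑-+ (x ∷ xs) g h = trans (cong (g x + h x +_) (∑-+ xs g h)) (+-CS.interchange (g x) (h x) (∑ xs g) (∑ xs h))

∑-*ˡ : (xs : List A) (c : ℕ) (g : A → ℕ) → ∑[ x ∈ xs ] (c * g x) ≡ c * ∑ xs g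
∑-*ˡ []       c g = sym (*-zeroʳ c)
∑-*ˡ (x ∷ xs) c g = trans (cong (c * g x +_) (∑-*ˡ xs c g)) (sym (*-distribˡ-+ c (g x) _))

∑-*ʳ : (xs : List A) (c : ℕ) (g : A → ℕ) → ∑[ x ∈ xs ] (g x * c) ≡ ∑ xs g * c
∑-*ʳ xs c g = trans (∑-cong xs (λ x → *-comm (g x) c)) (trans (∑-*ˡ xs c g) (*-comm c _))

∑-++ : (xs ys : List A) (g : A → ℕ) → ∑ (xs ++ ys) g ≡ ∑ xs g + ∑ ys g
∑-++ []       ys g = refl
∑-++ (x ∷ xs) ys g = trans (cong (g x +_) (∑-++ xs ys g)) (sym (+-assoc (g x) _ _))

∑-map : (h : A → B) (xs : List A) (g : B → ℕ) → ∑ (map h xs) g ≡ ∑ xs (g ∘ h)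
∑-map h []       g = refl
∑-map h (x ∷ xs) g = cong (g (h x) +_) (∑-map h xs g)

∑-concatMap : (h : A → List B) (xs : List A) (g : B → ℕ) →
  ∑ (concatMap h xs) g ≡ ∑[ x ∈ xs ] ∑ (h x) g
∑-concatMap h []       g = refl
∑-concatMap h (x ∷ xs) g = trans (∑-++ (h x) (concatMap h xs) g) (cong (∑ (h x) g +_) (∑-concatMap h xs g))

∑-comm : (xs : List A) (ys : List B) (g : A → B → ℕ) →
  ∑[ x ∈ xs ] ∑ ys (g x) ≡ ∑[ y ∈ ys ] ∑[ x ∈ xs ] g x y
∑-comm []       ys g = sym (trans (∑-const ys 0) (*-zeroʳ (length ys)))
∑-comm (x ∷ xs) ys g = trans (cong (∑ ys (g x) +_) (∑-comm xs ys g)) (sym (∑-+ ys (g x) _))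

∑-*-∑ : (xs : List A) (ys : List B) (g : A → ℕ) (h : B → ℕ) (c : ℕ) →
  ∑[ x ∈ xs ] ∑[ y ∈ ys ] (g x * h y * c) ≡ ∑ xs g * ∑ ys h * c
∑-*-∑ xs ys g h c = begin
  ∑[ x ∈ xs ] ∑[ y ∈ ys ] (g x * h y * c)   ≡⟨ ∑-cong xs (λ x → ∑-cong ys (λ y → *-assoc (g x) (h y) c)) ⟩
  ∑[ x ∈ xs ] ∑[ y ∈ ys ] (g x * (h y * c)) ≡⟨ ∑-cong xs (λ x → ∑-*ˡ ys (g x) _) ⟩
  ∑[ x ∈ xs ] (g x * ∑[ y ∈ ys ] (h y * c)) ≡⟨ ∑-*ʳ xs _ g ⟩
  ∑ xs g * ∑[ y ∈ ys ] (h y * c)            ≡⟨ cong (∑ xs g *_) (∑-*ʳ ys c h) ⟩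
  ∑ xs g * (∑ ys h * c)                     ≡⟨ *-assoc (∑ xs g) _ c ⟨
  ∑ xs g * ∑ ys h * c                       ∎
  where open ≡-Reasoning

∑-allFin-suc : ∀ n (g : Fin (suc n) → ℕ) → ∑ (allFin (suc n)) g ≡ g zero + ∑ (allFin n) (g ∘ suc)
∑-allFin-suc n g = cong (g zero +_) (trans (cong (λ is → ∑ is g) (sym (map-tabulate id suc))) (∑-map suc (allFin n) g))

-- Only `does d` is inspected, so ⟦ Dec.map′ f g d ⟧ reduces to ⟦ d ⟧; the δ-lemmas rely on this.
⟦_⟧ : {P : Set} → Dec P → ℕ
⟦ d ⟧ = if does d then 1 else 0

⟦⟧-yes : {P : Set} (d : Dec P) → P → ⟦ d ⟧ ≡ 1
⟦⟧-yes (yes _) p = refl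
⟦⟧-yes (no ¬p) p = ⊥-elim (¬p p)

⟦⟧-no : {P : Set} (d : Dec P) → ¬ P → ⟦ d ⟧ ≡ 0
⟦⟧-no (yes p) ¬p = ⊥-elim (¬p p)
⟦⟧-no (no _)  ¬p = refl

⟦⟧-≤ : {P Q : Set} (d : Dec P) (e : Dec Q) → (P → Q) → ⟦ d ⟧ ≤ ⟦ e ⟧
⟦⟧-≤ (yes p) e h = ≤-reflexive (sym (⟦⟧-yes e (h p)))
⟦⟧-≤ (no _)  e h = z≤n

⟦⟧-cong : {P Q : Set} (d : Dec P) (e : Dec Q) → (P → Q) → (Q → P) → ⟦ d ⟧ ≡ ⟦ e ⟧
⟦⟧-cong d e to from = ≤-antisym (⟦⟧-≤ d e to) (⟦⟧-≤ e d from)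

⟦⟧≤1 : {P : Set} (d : Dec P) → ⟦ d ⟧ ≤ 1
⟦⟧≤1 (yes _) = s≤s z≤n
⟦⟧≤1 (no _)  = z≤n

⟦⟧-× : {P Q : Set} (d : Dec P) (e : Dec Q) → ⟦ d ×-dec e ⟧ ≡ ⟦ d ⟧ * ⟦ e ⟧
⟦⟧-× (yes _) (yes _) = refl
⟦⟧-× (yes _) (no _)  = refl
⟦⟧-× (no _)  e       = refl

⟦⟧-×₃ : {P Q R : Set} (d : Dec P) (e : Dec Q) (k : Dec R) (z : ℕ) →
  ⟦ d ⟧ * (⟦ e ⟧ * (⟦ k ⟧ * z)) ≡ ⟦ d ×-dec (e ×-dec k) ⟧ * z
⟦⟧-×₃ (yes _) (yes _) (yes _) z = trans (*-identityˡ _) (*-identityˡ _)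
⟦⟧-×₃ (yes _) (yes _) (no _)  z = refl
⟦⟧-×₃ (yes _) (no _)  k       z = refl
⟦⟧-×₃ (no _)  e       k       z = refl

⟦¬⟧+⟦⟧≡1 : {P : Set} (d : Dec P) → ⟦ ¬? d ⟧ + ⟦ d ⟧ ≡ 1
⟦¬⟧+⟦⟧≡1 (yes _) = refl
⟦¬⟧+⟦⟧≡1 (no _)  = refl

⟦⟧*≤ : {P : Set} (d : Dec P) (x : ℕ) → ⟦ d ⟧ * x ≤ x
⟦⟧*≤ (yes _) x = ≤-reflexive (+-identityʳ x)
⟦⟧*≤ (no _)  x = z≤n

⟦⟧*-cong : {P : Set} (d : Dec P) {a b : ℕ} → (P → a ≡ b) → ⟦ d ⟧ * a ≡ ⟦ d ⟧ * b
⟦⟧*-cong (yes p) h = cong (_+ 0) (h p)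
⟦⟧*-cong (no _)  h = refl

length-filter≡∑⟦⟧ : {P : A → Set} (P? : ∀ x → Dec (P x)) (xs : List A) →
  length (filter P? xs) ≡ ∑[ x ∈ xs ] ⟦ P? x ⟧
length-filter≡∑⟦⟧ P? []       = refl
length-filter≡∑⟦⟧ P? (x ∷ xs) with P? x
... | yes _ = cong suc (length-filter≡∑⟦⟧ P? xs)
... | no _  = length-filter≡∑⟦⟧ P? xs

∑-filter : {P : A → Set} (P? : ∀ x → Dec (P x)) (xs : List A) (g : A → ℕ) →
  ∑ (filter P? xs) g ≡ ∑[ x ∈ xs ] (⟦ P? x ⟧ * g x)
∑-filter P? []       g = refl
∑-filter P? (x ∷ xs) g with P? x
... | yes _ = cong₂ _+_ (sym (+-identityʳ (g x))) (∑-filter P? xs g)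
... | no _  = ∑-filter P? xs g

-- Counting ordered tuples and disjoint families

_∈ᶠ?_ : ∀ {n} (x : Fin n) (T : List (Fin n)) → Dec (x ∈ T)
_∈ᶠ?_ {n} = _∈?_ where open DecMembership (_≟ᶠ_ {n})

∑-allFin-1 : ∀ n → ∑[ _ ∈ allFin n ] 1 ≡ n
∑-allFin-1 n = trans (∑-const (allFin n) 1) (trans (*-identityʳ _) (length-tabulate id))

∑-allFin-δ : ∀ n (t : Fin n) (g : Fin n → ℕ) → ∑[ a ∈ allFin n ] (⟦ a ≟ᶠ t ⟧ * g a) ≡ g t
∑-allFin-δ (suc n) zero g = begin
  ∑[ a ∈ allFin (suc n) ] (⟦ a ≟ᶠ zero ⟧ * g a) ≡⟨ ∑-allFin-suc n _ ⟩
  g zero + 0 + ∑[ _ ∈ allFin n ] 0              ≡⟨ cong₂ _+_ (+-identityʳ (g zero)) (∑-const (allFin n) 0) ⟩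
  g zero + length (allFin n) * 0                ≡⟨ cong (g zero +_) (*-zeroʳ (length (allFin n))) ⟩
  g zero + 0                                    ≡⟨ +-identityʳ (g zero) ⟩
  g zero                                        ∎
  where open ≡-Reasoning
∑-allFin-δ (suc n) (suc t) g = trans (∑-allFin-suc n (λ a → ⟦ a ≟ᶠ suc t ⟧ * g a)) (∑-allFin-δ n t (g ∘ suc))

⟦∈∷⟧ : ∀ {n} (a t : Fin n) (T : List (Fin n)) → t ∉ T →
  ⟦ a ∈ᶠ? (t ∷ T) ⟧ ≡ ⟦ a ≟ᶠ t ⟧ * 1 + ⟦ a ∈ᶠ? T ⟧
⟦∈∷⟧ a t T t∉T = by-cases (a ≟ᶠ t)
  where
  by-cases : (d : Dec (a ≡ t)) → ⟦ a ∈ᶠ? (t ∷ T) ⟧ ≡ ⟦ d ⟧ * 1 + ⟦ a ∈ᶠ? T ⟧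
  by-cases (yes refl) = trans (⟦⟧-yes (a ∈ᶠ? (t ∷ T)) (here refl)) (cong suc (sym (⟦⟧-no (a ∈ᶠ? T) t∉T)))
  by-cases (no a≢t)   =
    ⟦⟧-cong (a ∈ᶠ? (t ∷ T)) (a ∈ᶠ? T) (λ { (here a≡t) → ⊥-elim (a≢t a≡t) ; (there a∈T) → a∈T }) there

∑-allFin-∈ : ∀ n (T : List (Fin n)) → Unique T → ∑[ a ∈ allFin n ] ⟦ a ∈ᶠ? T ⟧ ≡ length T
∑-allFin-∈ n []      _ = trans (∑-const (allFin n) 0) (*-zeroʳ (length (allFin n)))
∑-allFin-∈ n (t ∷ T) (t∉T ∷ uT) = begin
  ∑[ a ∈ allFin n ] ⟦ a ∈ᶠ? (t ∷ T) ⟧                                      ≡⟨ ∑-cong (allFin n) (λ a → ⟦∈∷⟧ a t T (All¬⇒¬Any t∉T)) ⟩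
  ∑[ a ∈ allFin n ] (⟦ a ≟ᶠ t ⟧ * 1 + ⟦ a ∈ᶠ? T ⟧)                           ≡⟨ ∑-+ (allFin n) _ _ ⟩
  ∑[ a ∈ allFin n ] (⟦ a ≟ᶠ t ⟧ * 1) + ∑[ a ∈ allFin n ] ⟦ a ∈ᶠ? T ⟧         ≡⟨ cong₂ _+_ (∑-allFin-δ n t (λ _ → 1)) (∑-allFin-∈ n T uT) ⟩
  suc (length T)                                                            ∎
  where open ≡-Reasoning

∑-allFin-∉ : ∀ n (T : List (Fin n)) → Unique T → ∑[ a ∈ allFin n ] ⟦ ¬? (a ∈ᶠ? T) ⟧ ≡ n ∸ length T
∑-allFin-∉ n T uT = begin
  ∑[ a ∈ allFin n ] ⟦ ¬? (a ∈ᶠ? T) ⟧                                  ≡⟨ m+n∸n≡m _ (length T) ⟨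
  ∑[ a ∈ allFin n ] ⟦ ¬? (a ∈ᶠ? T) ⟧ + length T ∸ length T            ≡⟨ cong (λ k → ∑[ a ∈ allFin n ] ⟦ ¬? (a ∈ᶠ? T) ⟧ + k ∸ length T) (∑-allFin-∈ n T uT) ⟨
  ∑[ a ∈ allFin n ] ⟦ ¬? (a ∈ᶠ? T) ⟧ + ∑[ a ∈ allFin n ] ⟦ a ∈ᶠ? T ⟧ ∸ length T
                                                                      ≡⟨ cong (_∸ length T) (∑-+ (allFin n) _ _) ⟨
  ∑[ a ∈ allFin n ] (⟦ ¬? (a ∈ᶠ? T) ⟧ + ⟦ a ∈ᶠ? T ⟧) ∸ length T      ≡⟨ cong (_∸ length T) (∑-cong (allFin n) (λ a → ⟦¬⟧+⟦⟧≡1 (a ∈ᶠ? T))) ⟩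
  ∑[ _ ∈ allFin n ] 1 ∸ length T                                      ≡⟨ cong (_∸ length T) (∑-allFin-1 n) ⟩
  n ∸ length T                                                        ∎
  where open ≡-Reasoning

-- n (n ∸ 1) ⋯ (n ∸ k + 1), which is 0 when k > n.
falling : ℕ → ℕ → ℕ
falling n zero    = 1
falling n (suc k) = n * falling (n ∸ 1) k

falling-+ : ∀ n a b → falling n (a + b) ≡ falling n a * falling (n ∸ a) b
falling-+ n zero    b = sym (+-identityʳ (falling n b))
falling-+ n (suc a) b = begin
  n * falling (n ∸ 1) (a + b)                        ≡⟨ cong (n *_) (falling-+ (n ∸ 1) a b) ⟩
  n * (falling (n ∸ 1) a * falling (n ∸ 1 ∸ a) b)    ≡⟨ cong (λ k → n * (falling (n ∸ 1) a * falling k b)) (∸-+-assoc n 1 a) ⟩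
  n * (falling (n ∸ 1) a * falling (n ∸ suc a) b)    ≡⟨ *-assoc n _ _ ⟨
  n * falling (n ∸ 1) a * falling (n ∸ suc a) b      ∎
  where open ≡-Reasoning

falling≤^ : ∀ n k → falling n k ≤ n ^ k
falling≤^ n zero    = ≤-refl
falling≤^ n (suc k) = *-monoʳ-≤ n (≤-trans (falling≤^ (n ∸ 1) k) (^-monoˡ-≤ k (m∸n≤m n 1)))

Avoids : ∀ {n f} → List (Fin n) → Vec (Fin n) f → Set
Avoids T v = All (_∉ T) (toList v)

OrderedAvoiding : ∀ {n f} → List (Fin n) → Vec (Fin n) f → Set
OrderedAvoiding T v = IsOrdered v × Avoids T v

orderedAvoiding? : ∀ {n f} (T : List (Fin n)) (v : Vec (Fin n) f) → Dec (OrderedAvoiding T v)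
orderedAvoiding? T v = isOrdered? v ×-dec all? (λ x → ¬? (x ∈ᶠ? T)) (toList v)

∑-allTuples-suc : (xs : List A) (f : ℕ) (g : Vec A (suc f) → ℕ) →
  ∑ (allTuples xs (suc f)) g ≡ ∑[ a ∈ xs ] ∑[ v ∈ allTuples xs f ] g (a ∷ v)
∑-allTuples-suc xs f g = trans (∑-concatMap _ xs g) (∑-cong xs (λ a → ∑-map (a ∷_) (allTuples xs f) g))

⟦orderedAvoiding∷⟧ : ∀ {n f} (a : Fin n) (v : Vec (Fin n) f) (T : List (Fin n)) →
  ⟦ orderedAvoiding? T (a ∷ v) ⟧ ≡ ⟦ ¬? (a ∈ᶠ? T) ⟧ * ⟦ orderedAvoiding? (a ∷ T) v ⟧
⟦orderedAvoiding∷⟧ a v T =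
  trans (⟦⟧-cong (orderedAvoiding? T (a ∷ v)) (¬? (a ∈ᶠ? T) ×-dec orderedAvoiding? (a ∷ T) v) to from)
        (⟦⟧-× (¬? (a ∈ᶠ? T)) (orderedAvoiding? (a ∷ T) v))
  where
  to : OrderedAvoiding T (a ∷ v) → a ∉ T × OrderedAvoiding (a ∷ T) v
  to ((a∉v ∷ ov) , (a∉T ∷ avT)) =
    a∉T , ov , All.zipWith (λ { (a≢y , y∉T) → λ { (here y≡a) → a≢y (sym y≡a) ; (there y∈T) → y∉T y∈T } }) (a∉v , avT)
  from : a ∉ T × OrderedAvoiding (a ∷ T) v → OrderedAvoiding T (a ∷ v)
  from (a∉T , ov , av) = (All.map (λ y∉ a≡y → y∉ (here (sym a≡y))) av ∷ ov) , (a∉T ∷ All.map (λ y∉ y∈T → y∉ (there y∈T)) av)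

∑-orderedAvoiding : ∀ {n} f (T : List (Fin n)) → Unique T →
  ∑[ v ∈ allTuples (allFin n) f ] ⟦ orderedAvoiding? T v ⟧ ≡ falling (n ∸ length T) f
∑-orderedAvoiding zero    T uT = refl
∑-orderedAvoiding {n} (suc f) T uT = begin
  ∑[ v ∈ allTuples (allFin n) (suc f) ] ⟦ orderedAvoiding? T v ⟧
    ≡⟨ ∑-allTuples-suc (allFin n) f _ ⟩
  ∑[ a ∈ allFin n ] ∑[ v ∈ Vs ] ⟦ orderedAvoiding? T (a ∷ v) ⟧
    ≡⟨ ∑-cong (allFin n) (λ a → trans (∑-cong Vs (λ v → ⟦orderedAvoiding∷⟧ a v T)) (∑-*ˡ Vs ⟦ ¬? (a ∈ᶠ? T) ⟧ (λ v → ⟦ orderedAvoiding? (a ∷ T) v ⟧))) ⟩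
  ∑[ a ∈ allFin n ] (⟦ ¬? (a ∈ᶠ? T) ⟧ * ∑[ v ∈ Vs ] ⟦ orderedAvoiding? (a ∷ T) v ⟧)
    ≡⟨ ∑-cong (allFin n) (λ a → ⟦⟧*-cong (¬? (a ∈ᶠ? T)) (λ a∉T → ∑-orderedAvoiding f (a ∷ T) (¬Any⇒All¬ T a∉T ∷ uT))) ⟩
  ∑[ a ∈ allFin n ] (⟦ ¬? (a ∈ᶠ? T) ⟧ * falling (n ∸ suc (length T)) f)
    ≡⟨ ∑-*ʳ (allFin n) _ _ ⟩
  ∑[ a ∈ allFin n ] ⟦ ¬? (a ∈ᶠ? T) ⟧ * falling (n ∸ suc (length T)) f
    ≡⟨ cong₂ _*_ (∑-allFin-∉ n T uT) (cong (λ k → falling k f) (sym (pred[m∸n]≡m∸[1+n] n (length T)))) ⟩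
  (n ∸ length T) * falling (n ∸ length T ∸ 1) f
    ∎
  where
  open ≡-Reasoning
  Vs : List (Vec (Fin n) f)
  Vs = allTuples (allFin n) f

infix 4 _≟ᵛ_
_≟ᵛ_ : ∀ {n f} (u v : Vec (Fin n) f) → Dec (u ≡ v)
_≟ᵛ_ = Vec.≡-dec _≟ᶠ_

∑-allTuples-δ : ∀ {n} f (x : Vec (Fin n) f) (g : Vec (Fin n) f → ℕ) →
  ∑[ v ∈ allTuples (allFin n) f ] (⟦ v ≟ᵛ x ⟧ * g v) ≡ g x
∑-allTuples-δ zero    []      g = trans (+-identityʳ (g [] + 0)) (+-identityʳ (g []))
∑-allTuples-δ {n} (suc f) (b ∷ x) g = begin
  ∑[ v ∈ allTuples (allFin n) (suc f) ] (⟦ v ≟ᵛ b ∷ x ⟧ * g v)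
    ≡⟨ ∑-allTuples-suc (allFin n) f _ ⟩
  ∑[ a ∈ allFin n ] ∑[ v ∈ Vs ] (⟦ a ∷ v ≟ᵛ b ∷ x ⟧ * g (a ∷ v))
    ≡⟨ ∑-cong (allFin n) (λ a → trans (∑-cong Vs (split a)) (∑-*ˡ Vs ⟦ a ≟ᶠ b ⟧ (λ v → ⟦ v ≟ᵛ x ⟧ * g (a ∷ v)))) ⟩
  ∑[ a ∈ allFin n ] (⟦ a ≟ᶠ b ⟧ * ∑[ v ∈ Vs ] (⟦ v ≟ᵛ x ⟧ * g (a ∷ v)))
    ≡⟨ ∑-cong (allFin n) (λ a → cong (⟦ a ≟ᶠ b ⟧ *_) (∑-allTuples-δ f x (λ v → g (a ∷ v)))) ⟩
  ∑[ a ∈ allFin n ] (⟦ a ≟ᶠ b ⟧ * g (a ∷ x))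
    ≡⟨ ∑-allFin-δ n b (λ a → g (a ∷ x)) ⟩
  g (b ∷ x)
    ∎
  where
  open ≡-Reasoning
  Vs : List (Vec (Fin n) f)
  Vs = allTuples (allFin n) f
  split : ∀ a v → ⟦ a ∷ v ≟ᵛ b ∷ x ⟧ * g (a ∷ v) ≡ ⟦ a ≟ᶠ b ⟧ * (⟦ v ≟ᵛ x ⟧ * g (a ∷ v))
  split a v = trans (cong (_* g (a ∷ v)) (⟦⟧-× (a ≟ᶠ b) (v ≟ᵛ x))) (*-assoc ⟦ a ≟ᶠ b ⟧ _ _)

⟦⟧-regroup : {P Q R P′ Q′ : Set} (d : Dec P) (e : Dec Q) (k : Dec R) (d′ : Dec P′) (e′ : Dec Q′) →
  (P × Q × R → P′ × Q′) → (P′ × Q′ → P × Q × R) →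
  ∀ c → ⟦ d ⟧ * (⟦ e ⟧ * (⟦ k ⟧ * c)) ≡ ⟦ d′ ⟧ * (⟦ e′ ⟧ * c)
⟦⟧-regroup d e k d′ e′ to from c = begin
  ⟦ d ⟧ * (⟦ e ⟧ * (⟦ k ⟧ * c))  ≡⟨ ⟦⟧-×₃ d e k c ⟩
  ⟦ d ×-dec (e ×-dec k) ⟧ * c     ≡⟨ cong (_* c) (⟦⟧-cong (d ×-dec (e ×-dec k)) (d′ ×-dec e′) to from) ⟩
  ⟦ d′ ×-dec e′ ⟧ * c             ≡⟨ cong (_* c) (⟦⟧-× d′ e′) ⟩
  ⟦ d′ ⟧ * ⟦ e′ ⟧ * c             ≡⟨ *-assoc ⟦ d′ ⟧ ⟦ e′ ⟧ c ⟩
  ⟦ d′ ⟧ * (⟦ e′ ⟧ * c)           ∎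
  where open ≡-Reasoning

All∉-sym : {xs ys : List A} → All (_∉ ys) xs → All (_∉ xs) ys
All∉-sym {ys = []}     _ = []
All∉-sym {ys = y ∷ ys} h = (λ y∈xs → All.lookup h y∈xs (here refl)) ∷ All∉-sym (All.map (_∘ there) h)

∉-++⁻ : ∀ {x : A} S {T} → x ∉ S ++ T → x ∉ S × x ∉ T
∉-++⁻ S x∉ = x∉ ∘ ∈-++⁺ˡ , x∉ ∘ ∈-++⁺ʳ S

∉-++⁺ : ∀ {x : A} S {T} → x ∉ S → x ∉ T → x ∉ S ++ T
∉-++⁺ S x∉S x∉T x∈ with ∈-++⁻ S x∈
... | inj₁ x∈S = x∉S x∈S
... | inj₂ x∈T = x∉T x∈T

module _ {n f : ℕ} where

  avoids-++⁻ : ∀ S {T} (w : Vec (Fin n) f) → Avoids (S ++ T) w → Avoids S w × Avoids T w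
  avoids-++⁻ S w h = All.map (proj₁ ∘ ∉-++⁻ S) h , All.map (proj₂ ∘ ∉-++⁻ S) h

  avoids-++⁺ : ∀ S {T} (w : Vec (Fin n) f) → Avoids S w → Avoids T w → Avoids (S ++ T) w
  avoids-++⁺ S w hS hT = All.zipWith (λ { (x∉S , x∉T) → ∉-++⁺ S x∉S x∉T }) (hS , hT)

  Family : List (Fin n) → List (Vec (Fin n) f) → Set
  Family S L = All (OrderedAvoiding S) L × AllPairs DisjointV L

  family? : (S : List (Fin n)) (L : List (Vec (Fin n) f)) → Dec (Family S L)
  family? S L = all? (orderedAvoiding? S) L ×-dec allPairs? disjointV? L

  family-∷⁻ : ∀ S v L → Family S (v ∷ L) → OrderedAvoiding S v × Family (S ++ toList v) L
  family-∷⁻ S v L ((oav ∷ oaL) , (dv ∷ dL)) =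
    oav , All.zipWith (λ { (dvw , ow , aw) → ow , avoids-++⁺ S _ aw (All∉-sym dvw) }) (dv , oaL) , dL

  family-∷⁺ : ∀ S v L → OrderedAvoiding S v → Family (S ++ toList v) L → Family S (v ∷ L)
  family-∷⁺ S v L oav (oaL , dL) =
      (oav ∷ All.map (λ { (ow , aw) → ow , proj₁ (avoids-++⁻ S _ aw) }) oaL)
    , (All.map (λ { (_ , aw) → All∉-sym (proj₂ (avoids-++⁻ S _ aw)) }) oaL ∷ dL)

  family-swap : ∀ S v w L → Family S (v ∷ w ∷ L) → Family S (w ∷ v ∷ L)
  family-swap S v w L ((oav ∷ oaw ∷ oaL) , ((dvw ∷ dvL) ∷ (dwL ∷ dL))) =
    (oaw ∷ oav ∷ oaL) , ((All∉-sym dvw ∷ dwL) ∷ (dvL ∷ dL))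

  occupied : List (Fin n) → List (Vec (Fin n) f) → List (Fin n)
  occupied S []      = S
  occupied S (w ∷ L) = occupied (S ++ toList w) L

  family-∷-occupied⁻ : ∀ S v L → Family S (v ∷ L) → Family S L × OrderedAvoiding (occupied S L) v
  family-∷-occupied⁻ S v []      ((oav ∷ []) , _) = ([] , []) , oav
  family-∷-occupied⁻ S v (w ∷ L) h =
    let oaw , h′ = family-∷⁻ S w (v ∷ L) (family-swap S v w L h)
        hL , oav = family-∷-occupied⁻ (S ++ toList w) v L h′
    in family-∷⁺ S w L oaw hL , oav

  family-∷-occupied⁺ : ∀ S v L → Family S L → OrderedAvoiding (occupied S L) v → Family S (v ∷ L)
  family-∷-occupied⁺ S v []      _  oav = (oav ∷ []) , ([] ∷ [])
  family-∷-occupied⁺ S v (w ∷ L) hL oav =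
    let oaw , hL′ = family-∷⁻ S w L hL
    in family-swap S w v L (family-∷⁺ S w (v ∷ L) oaw (family-∷-occupied⁺ (S ++ toList w) v L hL′ oav))

  unique-++ : ∀ S (v : Vec (Fin n) f) → Unique S → OrderedAvoiding S v → Unique (S ++ toList v)
  unique-++ S v uS (ov , av) = Unique.++⁺ uS ov (λ (x∈S , x∈v) → All.lookup av x∈v x∈S)

  length-++-toList : ∀ S (v : Vec (Fin n) f) → length (S ++ toList v) ≡ length S + f
  length-++-toList S v = trans (length-++ S) (cong (length S +_) (Vec.length-toList v))

  unique-occupied : ∀ S L → Unique S → Family S L → Unique (occupied S L)
  unique-occupied S []      uS _ = uS
  unique-occupied S (w ∷ L) uS h =
    let oaw , h′ = family-∷⁻ S w L h in unique-occupied (S ++ toList w) L (unique-++ S w uS oaw) h′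

  length-occupied : ∀ S L → length (occupied S L) ≡ length S + f * length L
  length-occupied S []      = sym (trans (cong (length S +_) (*-zeroʳ f)) (+-identityʳ _))
  length-occupied S (w ∷ L) = begin
    length (occupied (S ++ toList w) L)   ≡⟨ length-occupied (S ++ toList w) L ⟩
    length (S ++ toList w) + f * length L ≡⟨ cong (_+ f * length L) (length-++-toList S w) ⟩
    length S + f + f * length L           ≡⟨ +-assoc (length S) f _ ⟩
    length S + (f + f * length L)         ≡⟨ cong (length S +_) (*-suc f (length L)) ⟨
    length S + f * suc (length L)         ∎
    where open ≡-Reasoning

  -- A pattern prescribes some coordinates of an m-tuple of f-subsets (just x) and leaves the others free.
  Pattern : ℕ → Set
  Pattern k = Vec (Maybe (Vec (Fin n) f)) k

  Fits : Maybe (Vec (Fin n) f) → Vec (Fin n) f → Set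
  Fits nothing  v = ⊤
  Fits (just x) v = v ≡ x

  fits? : (q : Maybe (Vec (Fin n) f)) (v : Vec (Fin n) f) → Dec (Fits q v)
  fits? nothing  v = yes tt
  fits? (just x) v = v ≟ᵛ x

  Matches : ∀ {k} → Pattern k → Vec (Vec (Fin n) f) k → Set
  Matches []      []      = ⊤
  Matches (q ∷ p) (v ∷ ω) = Fits q v × Matches p ω

  matches? : ∀ {k} (p : Pattern k) (ω : Vec (Vec (Fin n) f) k) → Dec (Matches p ω)
  matches? []      []      = yes tt
  matches? (q ∷ p) (v ∷ ω) = fits? q v ×-dec matches? p ω

  prescribed : ∀ {k} → Pattern k → List (Vec (Fin n) f)
  prescribed []            = []
  prescribed (nothing ∷ p) = prescribed p
  prescribed (just x ∷ p)  = x ∷ prescribed p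

  #free : ∀ {k} → Pattern k → ℕ
  #free []            = 0
  #free (nothing ∷ p) = suc (#free p)
  #free (just x ∷ p)  = #free p

  #matching : ∀ {k} → List (Fin n) → Pattern k → ℕ
  #matching {k} S p = ∑[ ω ∈ allTuples (ordSubsets n f) k ] ⟦ family? S (toList ω) ×-dec matches? p ω ⟧

  #matching-∷ : ∀ {k} S q (p : Pattern k) →
    #matching S (q ∷ p) ≡ ∑[ v ∈ ordSubsets n f ] (⟦ orderedAvoiding? S v ×-dec fits? q v ⟧ * #matching (S ++ toList v) p)
  #matching-∷ {k} S q p = trans (∑-allTuples-suc (ordSubsets n f) k _) (∑-cong (ordSubsets n f) λ v →
    trans (∑-cong Ωs (λ ω → split v ω)) (∑-*ˡ Ωs ⟦ orderedAvoiding? S v ×-dec fits? q v ⟧ (λ ω → ⟦ family? (S ++ toList v) (toList ω) ×-dec matches? p ω ⟧)))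
    where
    Ωs : List (Vec (Vec (Fin n) f) k)
    Ωs = allTuples (ordSubsets n f) k
    split : ∀ v ω →
      ⟦ family? S (v ∷ toList ω) ×-dec (fits? q v ×-dec matches? p ω) ⟧ ≡
      ⟦ orderedAvoiding? S v ×-dec fits? q v ⟧ * ⟦ family? (S ++ toList v) (toList ω) ×-dec matches? p ω ⟧
    split v ω = trans
      (⟦⟧-cong (family? S (v ∷ toList ω) ×-dec (fits? q v ×-dec matches? p ω))
               ((orderedAvoiding? S v ×-dec fits? q v) ×-dec (family? (S ++ toList v) (toList ω) ×-dec matches? p ω))
               (λ (h , fv , mω) → let oav , h′ = family-∷⁻ S v (toList ω) h in (oav , fv) , h′ , mω)
               (λ ((oav , fv) , h′ , mω) → family-∷⁺ S v (toList ω) oav h′ , fv , mω))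
      (⟦⟧-× (orderedAvoiding? S v ×-dec fits? q v) (family? (S ++ toList v) (toList ω) ×-dec matches? p ω))

  -- The prescribed tuples must form a family by themselves; each free coordinate is then filled
  -- by f distinct points among those not yet occupied.
  matchingCount : ∀ {k} → List (Fin n) → Pattern k → ℕ
  matchingCount S p = ⟦ family? S (prescribed p) ⟧ * falling (n ∸ (length S + f * length (prescribed p))) (f * #free p)

  CountsMatching : ∀ {k} → Pattern k → Set
  CountsMatching p = ∀ S → Unique S → #matching S p ≡ matchingCount S p

  #matching-∷-expand : ∀ {k} q (p : Pattern k) → CountsMatching p → ∀ S → Unique S →
    #matching S (q ∷ p) ≡
      ∑[ v ∈ allTuples (allFin n) f ] (⟦ isOrdered? v ⟧ * (⟦ orderedAvoiding? S v ×-dec fits? q v ⟧ *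
        (⟦ family? (S ++ toList v) (prescribed p) ⟧ * falling (n ∸ (length S + f + f * length (prescribed p))) (f * #free p))))
  #matching-∷-expand q p IH S uS = begin
    #matching S (q ∷ p)
      ≡⟨ #matching-∷ S q p ⟩
    ∑[ v ∈ ordSubsets n f ] (⟦ OA? v ⟧ * #matching (S ++ toList v) p)
      ≡⟨ ∑-cong (ordSubsets n f) (λ v → ⟦⟧*-cong (OA? v) λ (oav , _) → trans (IH (S ++ toList v) (unique-++ S v uS oav))
             (cong (λ t → ⟦ family? (S ++ toList v) fp ⟧ * falling (n ∸ (t + f * length fp)) (f * #free p)) (length-++-toList S v))) ⟩
    ∑[ v ∈ ordSubsets n f ] (⟦ OA? v ⟧ * (⟦ family? (S ++ toList v) fp ⟧ * c))
      ≡⟨ ∑-filter isOrdered? (allTuples (allFin n) f) _ ⟩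
    ∑[ v ∈ allTuples (allFin n) f ] (⟦ isOrdered? v ⟧ * (⟦ OA? v ⟧ * (⟦ family? (S ++ toList v) fp ⟧ * c)))
      ∎
    where
    open ≡-Reasoning
    fp : List (Vec (Fin n) f)
    fp = prescribed p
    c : ℕ
    c = falling (n ∸ (length S + f + f * length fp)) (f * #free p)
    OA? : (v : Vec (Fin n) f) → Dec (OrderedAvoiding S v × Fits q v)
    OA? v = orderedAvoiding? S v ×-dec fits? q v

  #matching-just : ∀ {k} x (p : Pattern k) → CountsMatching p → CountsMatching (just x ∷ p)
  #matching-just x p IH S uS = begin
    #matching S (just x ∷ p)
      ≡⟨ #matching-∷-expand (just x) p IH S uS ⟩
    ∑[ v ∈ allTuples (allFin n) f ] (⟦ isOrdered? v ⟧ * (⟦ orderedAvoiding? S v ×-dec v ≟ᵛ x ⟧ * (⟦ family? (S ++ toList v) fp ⟧ * c)))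
      ≡⟨ ∑-cong (allTuples (allFin n) f) (λ v → ⟦⟧-regroup (isOrdered? v) (orderedAvoiding? S v ×-dec v ≟ᵛ x) (family? (S ++ toList v) fp)
            (v ≟ᵛ x) (family? S (x ∷ fp))
            (λ { (_ , (oav , refl) , h) → refl , family-∷⁺ S x fp oav h })
            (λ { (refl , h) → let oax , h′ = family-∷⁻ S x fp h in proj₁ oax , (oax , refl) , h′ }) c) ⟩
    ∑[ v ∈ allTuples (allFin n) f ] (⟦ v ≟ᵛ x ⟧ * (⟦ family? S (x ∷ fp) ⟧ * c))
      ≡⟨ ∑-allTuples-δ f x (λ _ → ⟦ family? S (x ∷ fp) ⟧ * c) ⟩
    ⟦ family? S (x ∷ fp) ⟧ * c
      ≡⟨ cong (λ t → ⟦ family? S (x ∷ fp) ⟧ * falling (n ∸ t) (f * #free p)) length-prescribed ⟩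
    matchingCount S (just x ∷ p)
      ∎
    where
    open ≡-Reasoning
    fp : List (Vec (Fin n) f)
    fp = prescribed p
    c : ℕ
    c = falling (n ∸ (length S + f + f * length fp)) (f * #free p)
    length-prescribed : length S + f + f * length fp ≡ length S + f * suc (length fp)
    length-prescribed = trans (+-assoc (length S) f _) (cong (length S +_) (sym (*-suc f (length fp))))

  #matching-nothing : ∀ {k} (p : Pattern k) → CountsMatching p → CountsMatching (nothing ∷ p)
  #matching-nothing p IH S uS = begin
    #matching S (nothing ∷ p)
      ≡⟨ #matching-∷-expand nothing p IH S uS ⟩
    ∑[ v ∈ allTuples (allFin n) f ] (⟦ isOrdered? v ⟧ * (⟦ orderedAvoiding? S v ×-dec yes tt ⟧ * (⟦ family? (S ++ toList v) fp ⟧ * c)))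
      ≡⟨ ∑-cong (allTuples (allFin n) f) (λ v → ⟦⟧-regroup (isOrdered? v) (orderedAvoiding? S v ×-dec yes tt) (family? (S ++ toList v) fp)
            (family? S fp) (orderedAvoiding? (occupied S fp) v)
            (λ (_ , (oav , _) , h) → family-∷-occupied⁻ S v fp (family-∷⁺ S v fp oav h))
            (λ (hS , oav) → let oav′ , h = family-∷⁻ S v fp (family-∷-occupied⁺ S v fp hS oav) in proj₁ oav , (oav′ , tt) , h) c) ⟩
    ∑[ v ∈ allTuples (allFin n) f ] (⟦ family? S fp ⟧ * (⟦ orderedAvoiding? (occupied S fp) v ⟧ * c))
      ≡⟨ ∑-*ˡ (allTuples (allFin n) f) ⟦ family? S fp ⟧ _ ⟩
    ⟦ family? S fp ⟧ * ∑[ v ∈ allTuples (allFin n) f ] (⟦ orderedAvoiding? (occupied S fp) v ⟧ * c)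
      ≡⟨ ⟦⟧*-cong (family? S fp) (λ hS → trans (∑-*ʳ (allTuples (allFin n) f) c _) (cong (_* c)
            (trans (∑-orderedAvoiding f (occupied S fp) (unique-occupied S fp uS hS)) (cong (λ t → falling (n ∸ t) f) (length-occupied S fp))))) ⟩
    ⟦ family? S fp ⟧ * (falling N f * c)
      ≡⟨ cong (⟦ family? S fp ⟧ *_) fill-one-more ⟩
    matchingCount S (nothing ∷ p)
      ∎
    where
    open ≡-Reasoning
    fp : List (Vec (Fin n) f)
    fp = prescribed p
    s : ℕ
    s = length S
    a : ℕ
    a = f * length fp
    N : ℕ
    N = n ∸ (s + a)
    c : ℕ
    c = falling (n ∸ (s + f + a)) (f * #free p)
    fill-one-more : falling N f * c ≡ falling N (f * suc (#free p))
    fill-one-more = sym (begin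
      falling N (f * suc (#free p))                 ≡⟨ cong (falling N) (*-suc f (#free p)) ⟩
      falling N (f + f * #free p)                   ≡⟨ falling-+ N f (f * #free p) ⟩
      falling N f * falling (N ∸ f) (f * #free p)   ≡⟨ cong (λ t → falling N f * falling t (f * #free p)) (∸-+-assoc n (s + a) f) ⟩
      falling N f * falling (n ∸ (s + a + f)) (f * #free p)
                                                    ≡⟨ cong (λ t → falling N f * falling (n ∸ t) (f * #free p)) (+-CS.xy∙z≈xz∙y s a f) ⟩
      falling N f * c                               ∎)

  #matching≡ : ∀ {k} (p : Pattern k) → CountsMatching p
  #matching≡ []            S uS =
    sym (trans (+-identityʳ (falling (n ∸ (length S + f * 0)) (f * 0))) (cong (falling (n ∸ (length S + f * 0))) (*-zeroʳ f)))
  #matching≡ (just x ∷ p)  = #matching-just x p (#matching≡ p)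
  #matching≡ (nothing ∷ p) = #matching-nothing p (#matching≡ p)

  free : ∀ {k} → Pattern k
  free {zero}  = []
  free {suc k} = nothing ∷ free

  single : ∀ {k} → Fin k → Vec (Fin n) f → Pattern k
  single zero    x = just x ∷ free
  single (suc i) x = nothing ∷ single i x

  pair : ∀ {k} → Fin k → Fin k → Vec (Fin n) f → Vec (Fin n) f → Pattern k
  pair zero    zero    x y = just x ∷ free
  pair zero    (suc j) x y = just x ∷ single j y
  pair (suc i) zero    x y = just y ∷ single i x
  pair (suc i) (suc j) x y = nothing ∷ pair i j x y

  matches-free : ∀ {k} (ω : Vec (Vec (Fin n) f) k) → Matches free ω
  matches-free []      = tt
  matches-free (v ∷ ω) = tt , matches-free ω

  prescribed-free : ∀ k → prescribed (free {k}) ≡ []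
  prescribed-free zero    = refl
  prescribed-free (suc k) = prescribed-free k

  #free-free : ∀ k → #free (free {k}) ≡ k
  #free-free zero    = refl
  #free-free (suc k) = cong suc (#free-free k)

  prescribed-single : ∀ {k} (i : Fin k) x → prescribed (single i x) ≡ x ∷ []
  prescribed-single {suc k} zero x = cong (x ∷_) (prescribed-free k)
  prescribed-single (suc i)      x = prescribed-single i x

  #free≡k∸length-prescribed : ∀ {k} (p : Pattern k) → #free p ≡ k ∸ length (prescribed p)
  #free≡k∸length-prescribed {k} p = trans (sym (m+n∸n≡m (#free p) (length (prescribed p)))) (cong (_∸ length (prescribed p)) (count p))
    where
    count : ∀ {k} (p : Pattern k) → #free p + length (prescribed p) ≡ k
    count []            = refl
    count (nothing ∷ p) = cong suc (count p)
    count (just x ∷ p)  = trans (+-suc (#free p) _) (cong suc (count p))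

  matches-single⁻ : ∀ {k} (i : Fin k) x ω → Matches (single i x) ω → x ≡ lookup ω i
  matches-single⁻ zero    x (v ∷ ω) (v≡x , _) = sym v≡x
  matches-single⁻ (suc i) x (v ∷ ω) (_ , m)   = matches-single⁻ i x ω m

  matches-single⁺ : ∀ {k} (i : Fin k) x ω → x ≡ lookup ω i → Matches (single i x) ω
  matches-single⁺ zero    x (v ∷ ω) x≡v = sym x≡v , matches-free ω
  matches-single⁺ (suc i) x (v ∷ ω) x≡ω = tt , matches-single⁺ i x ω x≡ω

  matches-pair⁻ : ∀ {k} (i j : Fin k) → i ≢ j → ∀ x y ω → Matches (pair i j x y) ω → x ≡ lookup ω i × y ≡ lookup ω j
  matches-pair⁻ zero    zero    i≢j x y ω       _         = ⊥-elim (i≢j refl)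
  matches-pair⁻ zero    (suc j) i≢j x y (v ∷ ω) (v≡x , m) = sym v≡x , matches-single⁻ j y ω m
  matches-pair⁻ (suc i) zero    i≢j x y (v ∷ ω) (v≡y , m) = matches-single⁻ i x ω m , sym v≡y
  matches-pair⁻ (suc i) (suc j) i≢j x y (v ∷ ω) (_ , m)   = matches-pair⁻ i j (i≢j ∘ cong suc) x y ω m

  matches-pair⁺ : ∀ {k} (i j : Fin k) → i ≢ j → ∀ x y ω → x ≡ lookup ω i → y ≡ lookup ω j → Matches (pair i j x y) ω
  matches-pair⁺ zero    zero    i≢j x y ω       _   _   = ⊥-elim (i≢j refl)
  matches-pair⁺ zero    (suc j) i≢j x y (v ∷ ω) x≡v y≡ω = sym x≡v , matches-single⁺ j y ω y≡ω
  matches-pair⁺ (suc i) zero    i≢j x y (v ∷ ω) x≡ω y≡v = sym y≡v , matches-single⁺ i x ω x≡ω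
  matches-pair⁺ (suc i) (suc j) i≢j x y (v ∷ ω) x≡ω y≡ω = tt , matches-pair⁺ i j (i≢j ∘ cong suc) x y ω x≡ω y≡ω

  length-prescribed-pair : ∀ {k} (i j : Fin k) → i ≢ j → ∀ x y → length (prescribed (pair i j x y)) ≡ 2
  length-prescribed-pair zero    zero    i≢j x y = ⊥-elim (i≢j refl)
  length-prescribed-pair zero    (suc j) i≢j x y = cong (suc ∘ length) (prescribed-single j y)
  length-prescribed-pair (suc i) zero    i≢j x y = cong (suc ∘ length) (prescribed-single i x)
  length-prescribed-pair (suc i) (suc j) i≢j x y = length-prescribed-pair i j (i≢j ∘ cong suc) x y

  ∈-prescribed-pair : ∀ {k} (i j : Fin k) → i ≢ j → ∀ x y → x ∈ prescribed (pair i j x y) × y ∈ prescribed (pair i j x y)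
  ∈-prescribed-pair zero    zero    i≢j x y = ⊥-elim (i≢j refl)
  ∈-prescribed-pair zero    (suc j) i≢j x y rewrite prescribed-single j y = here refl , there (here refl)
  ∈-prescribed-pair (suc i) zero    i≢j x y rewrite prescribed-single i x = there (here refl) , here refl
  ∈-prescribed-pair (suc i) (suc j) i≢j x y = ∈-prescribed-pair i j (i≢j ∘ cong suc) x y

  ⟦disjointFamily⟧≡⟦family⟧ : ∀ {m} (ω : Vec (Vec (Fin n) f) m) → ⟦ isDisjointFamily? ω ⟧ ≡ ⟦ family? [] (toList ω) ⟧
  ⟦disjointFamily⟧≡⟦family⟧ ω = ⟦⟧-cong (isDisjointFamily? ω) (family? [] (toList ω))
    (λ (oω , dω) → All.map (λ ov → ov , All.tabulate (λ _ ())) oω , dω)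
    (λ (oaω , dω) → All.map proj₁ oaω , dω)

  ∑-Ω : ∀ m (g : Vec (Vec (Fin n) f) m → ℕ) →
    ∑ (Ω n f m) g ≡ ∑[ ω ∈ allTuples (ordSubsets n f) m ] (⟦ family? [] (toList ω) ⟧ * g ω)
  ∑-Ω m g = trans (∑-filter isDisjointFamily? (allTuples (ordSubsets n f) m) g)
                  (∑-cong (allTuples (ordSubsets n f) m) (λ ω → cong (_* g ω) (⟦disjointFamily⟧≡⟦family⟧ ω)))

  length-Ω : ∀ m → length (Ω n f m) ≡ falling n (f * m)
  length-Ω m = begin
    length (Ω n f m)
      ≡⟨ length-filter≡∑⟦⟧ isDisjointFamily? (allTuples (ordSubsets n f) m) ⟩
    ∑[ ω ∈ allTuples (ordSubsets n f) m ] ⟦ isDisjointFamily? ω ⟧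
      ≡⟨ ∑-cong (allTuples (ordSubsets n f) m) (λ ω → trans (⟦disjointFamily⟧≡⟦family⟧ ω)
            (⟦⟧-cong (family? [] (toList ω)) (family? [] (toList ω) ×-dec matches? free ω) (λ h → h , matches-free ω) proj₁)) ⟩
    #matching [] (free {m})
      ≡⟨ #matching≡ (free {m}) [] [] ⟩
    ⟦ family? [] (prescribed (free {m})) ⟧ * falling (n ∸ f * length (prescribed (free {m}))) (f * #free (free {m}))
      ≡⟨ cong (λ L → ⟦ family? [] L ⟧ * falling (n ∸ f * length L) (f * #free (free {m}))) (prescribed-free m) ⟩
    falling (n ∸ f * 0) (f * #free (free {m})) + 0
      ≡⟨ +-identityʳ _ ⟩
    falling (n ∸ f * 0) (f * #free (free {m}))
      ≡⟨ cong₂ (λ a b → falling (n ∸ a) (f * b)) (*-zeroʳ f) (#free-free m) ⟩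
    falling n (f * m)
      ∎
    where open ≡-Reasoning

  -- The number of ways to complete one (resp. two) prescribed coordinates to an element of Ω n f m.
  extensions₁ extensions₂ : ℕ → ℕ
  extensions₁ m = falling (n ∸ f) (f * (m ∸ 1))
  extensions₂ m = falling (n ∸ (f + f)) (f * (m ∸ 2))

  #matching-single : ∀ {m} (i : Fin m) x → #matching [] (single i x) ≡ ⟦ isOrdered? x ⟧ * extensions₁ m
  #matching-single {m} i x = begin
    #matching [] (single i x)
      ≡⟨ #matching≡ (single i x) [] [] ⟩
    ⟦ family? [] fp ⟧ * falling (n ∸ f * length fp) (f * #free (single i x))
      ≡⟨ cong (λ L → ⟦ family? [] L ⟧ * falling (n ∸ f * length L) (f * #free (single i x))) (prescribed-single i x) ⟩
    ⟦ family? [] (x ∷ []) ⟧ * falling (n ∸ f * 1) (f * #free (single i x))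
      ≡⟨ cong₂ _*_ (⟦⟧-cong (family? [] (x ∷ [])) (isOrdered? x) (λ { (((ox , _) ∷ []) , _) → ox }) (λ ox → ((ox , All.tabulate (λ _ ())) ∷ []) , ([] ∷ [])))
                   (cong₂ (λ a b → falling (n ∸ a) (f * b)) (*-identityʳ f)
                          (trans (#free≡k∸length-prescribed (single i x)) (cong (λ L → m ∸ length L) (prescribed-single i x)))) ⟩
    ⟦ isOrdered? x ⟧ * extensions₁ m
      ∎
    where
    open ≡-Reasoning
    fp : List (Vec (Fin n) f)
    fp = prescribed (single i x)

  #matching-pair : ∀ {m} (i j : Fin m) → i ≢ j → ∀ x y → #matching [] (pair i j x y) ≤ ⟦ isOrdered? x ⟧ * ⟦ isOrdered? y ⟧ * extensions₂ m
  #matching-pair {m} i j i≢j x y = begin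
    #matching [] (pair i j x y)
      ≡⟨ #matching≡ (pair i j x y) [] [] ⟩
    ⟦ family? [] fp ⟧ * falling (n ∸ f * length fp) (f * #free (pair i j x y))
      ≡⟨ cong₂ (λ a b → ⟦ family? [] fp ⟧ * falling (n ∸ a) (f * b)) f*|fp|≡f+f #free-pair ⟩
    ⟦ family? [] fp ⟧ * extensions₂ m
      ≤⟨ *-monoˡ-≤ (extensions₂ m) (≤-trans (⟦⟧-≤ (family? [] fp) (isOrdered? x ×-dec isOrdered? y) both-ordered)
                                            (≤-reflexive (⟦⟧-× (isOrdered? x) (isOrdered? y)))) ⟩
    ⟦ isOrdered? x ⟧ * ⟦ isOrdered? y ⟧ * extensions₂ m
      ∎
    where
    open ≤-Reasoning
    fp : List (Vec (Fin n) f)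
    fp = prescribed (pair i j x y)
    both-ordered : Family [] fp → IsOrdered x × IsOrdered y
    both-ordered (oafp , _) = let x∈fp , y∈fp = ∈-prescribed-pair i j i≢j x y in
      proj₁ (All.lookup oafp x∈fp) , proj₁ (All.lookup oafp y∈fp)
    f*|fp|≡f+f : f * length fp ≡ f + f
    f*|fp|≡f+f = trans (cong (f *_) (length-prescribed-pair i j i≢j x y)) (trans (*-suc f 1) (cong (f +_) (*-identityʳ f)))
    #free-pair : #free (pair i j x y) ≡ m ∸ 2
    #free-pair = trans (#free≡k∸length-prescribed (pair i j x y)) (cong (m ∸_) (length-prescribed-pair i j i≢j x y))

  -- Writing g (lookup ω i) as ∑ₓ ⟦ x ≡ lookup ω i ⟧ * g x and exchanging the sums turns moments
  -- over Ω into counts of families matching a pattern.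
  ∑-matching-single : ∀ {m} (i : Fin m) (g : Vec (Fin n) f → ℕ) (ω : Vec (Vec (Fin n) f) m) →
    ∑[ x ∈ allTuples (allFin n) f ] (⟦ family? [] (toList ω) ×-dec matches? (single i x) ω ⟧ * g x) ≡
    ⟦ family? [] (toList ω) ⟧ * g (lookup ω i)
  ∑-matching-single i g ω = begin
    ∑[ x ∈ Vs ] (⟦ Fω ×-dec matches? (single i x) ω ⟧ * g x)
      ≡⟨ ∑-cong Vs (λ x → cong (_* g x) (⟦⟧-cong (Fω ×-dec matches? (single i x) ω) (x ≟ᵛ lookup ω i ×-dec Fω)
            (λ (h , mω) → matches-single⁻ i x ω mω , h) (λ (x≡ωi , h) → h , matches-single⁺ i x ω x≡ωi))) ⟩
    ∑[ x ∈ Vs ] (⟦ x ≟ᵛ lookup ω i ×-dec Fω ⟧ * g x)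
      ≡⟨ ∑-cong Vs (λ x → trans (cong (_* g x) (⟦⟧-× (x ≟ᵛ lookup ω i) Fω)) (*-assoc ⟦ x ≟ᵛ lookup ω i ⟧ _ (g x))) ⟩
    ∑[ x ∈ Vs ] (⟦ x ≟ᵛ lookup ω i ⟧ * (⟦ Fω ⟧ * g x))
      ≡⟨ ∑-allTuples-δ f (lookup ω i) (λ x → ⟦ Fω ⟧ * g x) ⟩
    ⟦ Fω ⟧ * g (lookup ω i)
      ∎
    where
    open ≡-Reasoning
    Vs : List (Vec (Fin n) f)
    Vs = allTuples (allFin n) f
    Fω : Dec (Family [] (toList ω))
    Fω = family? [] (toList ω)

  ∑-matching-pair : ∀ {m} (i j : Fin m) → i ≢ j → (g h : Vec (Fin n) f → ℕ) (ω : Vec (Vec (Fin n) f) m) →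
    ∑[ x ∈ allTuples (allFin n) f ] ∑[ y ∈ allTuples (allFin n) f ] (⟦ family? [] (toList ω) ×-dec matches? (pair i j x y) ω ⟧ * (g x * h y)) ≡
    ⟦ family? [] (toList ω) ⟧ * (g (lookup ω i) * h (lookup ω j))
  ∑-matching-pair i j i≢j g h ω = begin
    ∑[ x ∈ Vs ] ∑[ y ∈ Vs ] (⟦ Fω ×-dec matches? (pair i j x y) ω ⟧ * (g x * h y))
      ≡⟨ ∑-cong Vs (λ x → ∑-cong Vs (λ y → trans (cong (_* (g x * h y))
            (⟦⟧-cong (Fω ×-dec matches? (pair i j x y) ω) (x ≟ᵛ lookup ω i ×-dec (y ≟ᵛ lookup ω j ×-dec Fω))
               (λ (hω , mω) → let x≡ωi , y≡ωj = matches-pair⁻ i j i≢j x y ω mω in x≡ωi , y≡ωj , hω)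
               (λ (x≡ωi , y≡ωj , hω) → hω , matches-pair⁺ i j i≢j x y ω x≡ωi y≡ωj)))
            (sym (⟦⟧-×₃ (x ≟ᵛ lookup ω i) (y ≟ᵛ lookup ω j) Fω (g x * h y))))) ⟩
    ∑[ x ∈ Vs ] ∑[ y ∈ Vs ] (⟦ x ≟ᵛ lookup ω i ⟧ * (⟦ y ≟ᵛ lookup ω j ⟧ * (⟦ Fω ⟧ * (g x * h y))))
      ≡⟨ ∑-cong Vs (λ x → ∑-*ˡ Vs ⟦ x ≟ᵛ lookup ω i ⟧ (λ y → ⟦ y ≟ᵛ lookup ω j ⟧ * (⟦ Fω ⟧ * (g x * h y)))) ⟩
    ∑[ x ∈ Vs ] (⟦ x ≟ᵛ lookup ω i ⟧ * ∑[ y ∈ Vs ] (⟦ y ≟ᵛ lookup ω j ⟧ * (⟦ Fω ⟧ * (g x * h y))))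
      ≡⟨ ∑-cong Vs (λ x → cong (⟦ x ≟ᵛ lookup ω i ⟧ *_) (∑-allTuples-δ f (lookup ω j) (λ y → ⟦ Fω ⟧ * (g x * h y)))) ⟩
    ∑[ x ∈ Vs ] (⟦ x ≟ᵛ lookup ω i ⟧ * (⟦ Fω ⟧ * (g x * h (lookup ω j))))
      ≡⟨ ∑-allTuples-δ f (lookup ω i) (λ x → ⟦ Fω ⟧ * (g x * h (lookup ω j))) ⟩
    ⟦ Fω ⟧ * (g (lookup ω i) * h (lookup ω j))
      ∎
    where
    open ≡-Reasoning
    Vs : List (Vec (Fin n) f)
    Vs = allTuples (allFin n) f
    Fω : Dec (Family [] (toList ω))
    Fω = family? [] (toList ω)

  ∑Ω-lookup : ∀ {m} (i : Fin m) (g : Vec (Fin n) f → ℕ) →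
    ∑[ ω ∈ Ω n f m ] g (lookup ω i) ≡ ∑ (ordSubsets n f) g * extensions₁ m
  ∑Ω-lookup {m} i g = begin
    ∑[ ω ∈ Ω n f m ] g (lookup ω i)
      ≡⟨ ∑-Ω m _ ⟩
    ∑[ ω ∈ Ωs ] (⟦ family? [] (toList ω) ⟧ * g (lookup ω i))
      ≡⟨ ∑-cong Ωs (λ ω → sym (∑-matching-single i g ω)) ⟩
    ∑[ ω ∈ Ωs ] ∑[ x ∈ Vs ] (⟦ family? [] (toList ω) ×-dec matches? (single i x) ω ⟧ * g x)
      ≡⟨ ∑-comm Ωs Vs _ ⟩
    ∑[ x ∈ Vs ] ∑[ ω ∈ Ωs ] (⟦ family? [] (toList ω) ×-dec matches? (single i x) ω ⟧ * g x)
      ≡⟨ ∑-cong Vs (λ x → ∑-*ʳ Ωs (g x) _) ⟩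
    ∑[ x ∈ Vs ] (#matching [] (single i x) * g x)
      ≡⟨ ∑-cong Vs (λ x → trans (cong (_* g x) (#matching-single i x)) (*-CS.xy∙z≈x∙zy ⟦ isOrdered? x ⟧ (extensions₁ m) (g x))) ⟩
    ∑[ x ∈ Vs ] (⟦ isOrdered? x ⟧ * (g x * extensions₁ m))
      ≡⟨ ∑-filter isOrdered? Vs _ ⟨
    ∑[ x ∈ ordSubsets n f ] (g x * extensions₁ m)
      ≡⟨ ∑-*ʳ (ordSubsets n f) (extensions₁ m) g ⟩
    ∑ (ordSubsets n f) g * extensions₁ m
      ∎
    where
    open ≡-Reasoning
    Ωs : List (Vec (Vec (Fin n) f) m)
    Ωs = allTuples (ordSubsets n f) m
    Vs : List (Vec (Fin n) f)
    Vs = allTuples (allFin n) f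

  ∑Ω-lookup-pair : ∀ {m} (i j : Fin m) → i ≢ j → (g h : Vec (Fin n) f → ℕ) →
    ∑[ ω ∈ Ω n f m ] (g (lookup ω i) * h (lookup ω j)) ≤ ∑ (ordSubsets n f) g * ∑ (ordSubsets n f) h * extensions₂ m
  ∑Ω-lookup-pair {m} i j i≢j g h = begin
    ∑[ ω ∈ Ω n f m ] (g (lookup ω i) * h (lookup ω j))
      ≡⟨ ∑-Ω m _ ⟩
    ∑[ ω ∈ Ωs ] (⟦ family? [] (toList ω) ⟧ * (g (lookup ω i) * h (lookup ω j)))
      ≡⟨ ∑-cong Ωs (λ ω → sym (∑-matching-pair i j i≢j g h ω)) ⟩
    ∑[ ω ∈ Ωs ] ∑[ x ∈ Vs ] ∑[ y ∈ Vs ] T ω x y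
      ≡⟨ ∑-comm Ωs Vs _ ⟩
    ∑[ x ∈ Vs ] ∑[ ω ∈ Ωs ] ∑[ y ∈ Vs ] T ω x y
      ≡⟨ ∑-cong Vs (λ x → ∑-comm Ωs Vs (λ ω y → T ω x y)) ⟩
    ∑[ x ∈ Vs ] ∑[ y ∈ Vs ] ∑[ ω ∈ Ωs ] T ω x y
      ≡⟨ ∑-cong Vs (λ x → ∑-cong Vs (λ y → ∑-*ʳ Ωs (g x * h y) _)) ⟩
    ∑[ x ∈ Vs ] ∑[ y ∈ Vs ] (#matching [] (pair i j x y) * (g x * h y))
      ≤⟨ ∑-mono-≤ Vs (λ x → ∑-mono-≤ Vs (λ y → ≤-trans (*-monoˡ-≤ (g x * h y) (#matching-pair i j i≢j x y))
            (≤-reflexive (regroup ⟦ isOrdered? x ⟧ ⟦ isOrdered? y ⟧ (extensions₂ m) (g x) (h y))))) ⟩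
    ∑[ x ∈ Vs ] ∑[ y ∈ Vs ] (⟦ isOrdered? x ⟧ * g x * (⟦ isOrdered? y ⟧ * h y) * extensions₂ m)
      ≡⟨ ∑-*-∑ Vs Vs _ _ (extensions₂ m) ⟩
    ∑[ x ∈ Vs ] (⟦ isOrdered? x ⟧ * g x) * ∑[ y ∈ Vs ] (⟦ isOrdered? y ⟧ * h y) * extensions₂ m
      ≡⟨ cong₂ (λ a b → a * b * extensions₂ m) (∑-filter isOrdered? Vs g) (∑-filter isOrdered? Vs h) ⟨
    ∑ (ordSubsets n f) g * ∑ (ordSubsets n f) h * extensions₂ m
      ∎
    where
    open ≤-Reasoning
    Ωs : List (Vec (Vec (Fin n) f) m)
    Ωs = allTuples (ordSubsets n f) m
    Vs : List (Vec (Fin n) f)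
    Vs = allTuples (allFin n) f
    T : Vec (Vec (Fin n) f) m → Vec (Fin n) f → Vec (Fin n) f → ℕ
    T ω x y = ⟦ family? [] (toList ω) ×-dec matches? (pair i j x y) ω ⟧ * (g x * h y)
    regroup : ∀ a b c u v → a * b * c * (u * v) ≡ a * u * (b * v) * c
    regroup = solve-∀

-- The second-moment method

m²+n²≡∣m-n∣²+2mn : ∀ m n → m * m + n * n ≡ ∣ m - n ∣ * ∣ m - n ∣ + 2 * m * n
m²+n²≡∣m-n∣²+2mn m n with ≤-total m n
... | inj₁ m≤n = begin
  m * m + n * n                        ≡⟨ cong (λ k → m * m + k * k) (m+[n∸m]≡n m≤n) ⟨
  m * m + (m + d) * (m + d)            ≡⟨ expand m d ⟩
  d * d + 2 * m * (m + d)              ≡⟨ cong₂ (λ a b → a * a + 2 * m * b) (sym (m≤n⇒∣m-n∣≡n∸m m≤n)) (m+[n∸m]≡n m≤n) ⟩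
  ∣ m - n ∣ * ∣ m - n ∣ + 2 * m * n    ∎
  where
  open ≡-Reasoning
  d : ℕ
  d = n ∸ m
  expand : ∀ m d → m * m + (m + d) * (m + d) ≡ d * d + 2 * m * (m + d)
  expand = solve-∀
... | inj₂ n≤m = begin
  m * m + n * n                        ≡⟨ cong (λ k → k * k + n * n) (m+[n∸m]≡n n≤m) ⟨
  (n + d) * (n + d) + n * n            ≡⟨ expand n d ⟩
  d * d + 2 * (n + d) * n              ≡⟨ cong₂ (λ a b → a * a + 2 * b * n) (sym (m≤n⇒∣n-m∣≡n∸m n≤m)) (m+[n∸m]≡n n≤m) ⟩
  ∣ m - n ∣ * ∣ m - n ∣ + 2 * m * n    ∎
  where
  open ≡-Reasoning
  d : ℕ
  d = m ∸ n
  expand : ∀ n d → (n + d) * (n + d) + n * n ≡ d * d + 2 * (n + d) * n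
  expand = solve-∀

2m<n⇒n²≤4∣m-n∣² : ∀ m n → 2 * m < n → n * n ≤ 4 * (∣ m - n ∣ * ∣ m - n ∣)
2m<n⇒n²≤4∣m-n∣² m n 2m<n = begin
  n * n                       ≤⟨ *-mono-≤ n≤2d n≤2d ⟩
  2 * d * (2 * d)             ≡⟨ regroup d ⟩
  4 * (d * d)                 ≡⟨ cong (λ k → 4 * (k * k)) (m≤n⇒∣m-n∣≡n∸m m≤n) ⟨
  4 * (∣ m - n ∣ * ∣ m - n ∣) ∎
  where
  open ≤-Reasoning
  d : ℕ
  d = n ∸ m
  m≤n : m ≤ n
  m≤n = ≤-trans (m≤m+n m (m + 0)) (<⇒≤ 2m<n)
  n≤2d : n ≤ 2 * d
  n≤2d = +-cancelˡ-≤ (2 * m) n (2 * d) (≤-trans (+-monoˡ-≤ n (<⇒≤ 2m<n)) (≤-reflexive (twice m≤n)))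
    where
    twice : m ≤ n → n + n ≡ 2 * m + 2 * (n ∸ m)
    twice m≤n = trans (cong₂ _+_ (sym (m+[n∸m]≡n m≤n)) (sym (m+[n∸m]≡n m≤n))) (distribute m (n ∸ m))
      where
      distribute : ∀ a b → a + b + (a + b) ≡ 2 * a + 2 * b
      distribute = solve-∀
  regroup : ∀ d → 2 * d * (2 * d) ≡ 4 * (d * d)
  regroup = solve-∀

module Chebyshev {X : Set} (xs : List X) (N : X → ℕ) where

  M S₁ S₂ : ℕ
  M  = length xs
  S₁ = ∑ xs N
  S₂ = ∑[ x ∈ xs ] (N x * N x)

  deviation² : X → ℕ
  deviation² x = ∣ M * N x - S₁ ∣ * ∣ M * N x - S₁ ∣

  ∑-deviation² : ∑ xs deviation² + M * (S₁ * S₁) ≡ M * (M * S₂)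
  ∑-deviation² = +-cancelʳ-≡ (M * (S₁ * S₁)) _ _ (begin
    ∑ xs deviation² + M * (S₁ * S₁) + M * (S₁ * S₁)
      ≡⟨ regroup (∑ xs deviation²) M S₁ ⟩
    ∑ xs deviation² + 2 * M * S₁ * S₁
      ≡⟨ cong (∑ xs deviation² +_) (trans (∑-*ˡ xs (2 * M * S₁) N) (*-CS.xy∙z≈xz∙y (2 * M) S₁ S₁)) ⟨
    ∑ xs deviation² + ∑[ x ∈ xs ] (2 * M * S₁ * N x)
      ≡⟨ ∑-+ xs deviation² _ ⟨
    ∑[ x ∈ xs ] (deviation² x + 2 * M * S₁ * N x)
      ≡⟨ ∑-cong xs (λ x → trans (cong (deviation² x +_) (commute M S₁ (N x))) (sym (m²+n²≡∣m-n∣²+2mn (M * N x) S₁))) ⟩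
    ∑[ x ∈ xs ] (M * N x * (M * N x) + S₁ * S₁)
      ≡⟨ ∑-+ xs _ _ ⟩
    ∑[ x ∈ xs ] (M * N x * (M * N x)) + ∑[ _ ∈ xs ] (S₁ * S₁)
      ≡⟨ cong₂ _+_ (trans (∑-cong xs (λ x → square M (N x))) (∑-*ˡ xs (M * M) _)) (∑-const xs (S₁ * S₁)) ⟩
    M * M * S₂ + M * (S₁ * S₁)
      ≡⟨ cong (_+ M * (S₁ * S₁)) (*-assoc M M S₂) ⟩
    M * (M * S₂) + M * (S₁ * S₁)
      ∎)
    where
    open ≡-Reasoning
    regroup : ∀ t m s → t + m * (s * s) + m * (s * s) ≡ t + 2 * m * s * s
    regroup = solve-∀
    commute : ∀ m s k → 2 * m * s * k ≡ 2 * (m * k) * s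
    commute = solve-∀
    square : ∀ m k → m * k * (m * k) ≡ m * m * (k * k)
    square = solve-∀

  -- Markov's inequality for the squared deviation from the mean S₁ / M.
  below-half-mean : {Low : X → Set} (low? : ∀ x → Dec (Low x)) → (∀ x → Low x → 2 * (M * N x) < S₁) →
    ∑[ x ∈ xs ] ⟦ low? x ⟧ * (S₁ * S₁) ≤ 4 * ∑ xs deviation²
  below-half-mean {Low} low? below = begin
    ∑[ x ∈ xs ] ⟦ low? x ⟧ * (S₁ * S₁)        ≡⟨ ∑-*ʳ xs (S₁ * S₁) _ ⟨
    ∑[ x ∈ xs ] (⟦ low? x ⟧ * (S₁ * S₁))      ≤⟨ ∑-mono-≤ xs (λ x → pointwise x (low? x)) ⟩
    ∑[ x ∈ xs ] (4 * deviation² x)          ≡⟨ ∑-*ˡ xs 4 deviation² ⟩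
    4 * ∑ xs deviation²                     ∎
    where
    open ≤-Reasoning
    pointwise : ∀ x (d : Dec (Low x)) → ⟦ d ⟧ * (S₁ * S₁) ≤ 4 * deviation² x
    pointwise x (yes p) = ≤-trans (≤-reflexive (+-identityʳ _)) (2m<n⇒n²≤4∣m-n∣² (M * N x) S₁ (below x p))
    pointwise x (no _)  = z≤n

  chebyshev : ∀ E → M * S₂ ≤ S₁ * S₁ + E * (M * S₁) →
    {Low : X → Set} (low? : ∀ x → Dec (Low x)) → (∀ x → Low x → 2 * (M * N x) < S₁) →
    ∑[ x ∈ xs ] ⟦ low? x ⟧ * S₁ ≤ 4 * E * (M * M)
  chebyshev E variance low? below = cancel-S₁ (S₁ ≟ 0)
    where
    open ≤-Reasoning
    #P : ℕ
    #P = ∑[ x ∈ xs ] ⟦ low? x ⟧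
    regroup : ∀ m s e → 4 * (m * (s * s + e * (m * s))) ≡ 4 * e * (m * m) * s + 4 * (m * (s * s))
    regroup = solve-∀
    bound : #P * S₁ * S₁ ≤ 4 * E * (M * M) * S₁
    bound = +-cancelʳ-≤ (4 * (M * (S₁ * S₁))) _ _ (begin
      #P * S₁ * S₁ + 4 * (M * (S₁ * S₁))             ≡⟨ cong (_+ 4 * (M * (S₁ * S₁))) (*-assoc #P S₁ S₁) ⟩
      #P * (S₁ * S₁) + 4 * (M * (S₁ * S₁))           ≤⟨ +-monoˡ-≤ _ (below-half-mean low? below) ⟩
      4 * ∑ xs deviation² + 4 * (M * (S₁ * S₁))      ≡⟨ *-distribˡ-+ 4 (∑ xs deviation²) (M * (S₁ * S₁)) ⟨
      4 * (∑ xs deviation² + M * (S₁ * S₁))          ≡⟨ cong (4 *_) ∑-deviation² ⟩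
      4 * (M * (M * S₂))                             ≤⟨ *-monoʳ-≤ 4 (*-monoʳ-≤ M variance) ⟩
      4 * (M * (S₁ * S₁ + E * (M * S₁)))             ≡⟨ regroup M S₁ E ⟩
      4 * E * (M * M) * S₁ + 4 * (M * (S₁ * S₁))     ∎)
    cancel-S₁ : Dec (S₁ ≡ 0) → #P * S₁ ≤ 4 * E * (M * M)
    cancel-S₁ (yes S₁≡0) = ≤-trans (≤-reflexive (trans (cong (#P *_) S₁≡0) (*-zeroʳ #P))) z≤n
    cancel-S₁ (no S₁≢0)  = *-cancelʳ-≤ _ _ S₁ {{≢-nonZero S₁≢0}} bound

n≤1⇒n*n≡n : ∀ {n} → n ≤ 1 → n * n ≡ n
n≤1⇒n*n≡n z≤n       = refl
n≤1⇒n*n≡n (s≤s z≤n) = refl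

m≤1⇒Fin-irrelevant : ∀ {m} → m ≤ 1 → (i j : Fin m) → i ≡ j
m≤1⇒Fin-irrelevant {suc zero}    _        zero zero = refl
m≤1⇒Fin-irrelevant {suc (suc _)} (s≤s ()) i    j

P*C≤C*Q+D*P*Q : ∀ m P Q D C → C ≤ m * P → m * P ≤ m * Q + D * Q → P * C ≤ C * Q + D * P * Q
P*C≤C*Q+D*P*Q m P Q D C C≤mP mP≤mQ+DQ = begin
  P * C                          ≤⟨ *-monoˡ-≤ C (m≤n+m∸n P Q) ⟩
  (Q + (P ∸ Q)) * C              ≡⟨ *-distribʳ-+ C Q (P ∸ Q) ⟩
  Q * C + (P ∸ Q) * C            ≤⟨ +-monoʳ-≤ (Q * C) (*-monoʳ-≤ (P ∸ Q) C≤mP) ⟩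
  Q * C + (P ∸ Q) * (m * P)      ≡⟨ cong (Q * C +_) (regroup (P ∸ Q) m P) ⟩
  Q * C + P * (m * (P ∸ Q))      ≤⟨ +-monoʳ-≤ (Q * C) (*-monoʳ-≤ P m[P∸Q]≤DQ) ⟩
  Q * C + P * (D * Q)            ≡⟨ regroup′ Q C P D ⟩
  C * Q + D * P * Q              ∎
  where
  open ≤-Reasoning
  m[P∸Q]≤DQ : m * (P ∸ Q) ≤ D * Q
  m[P∸Q]≤DQ = ≤-trans (≤-reflexive (*-distribˡ-∸ m P Q)) (m≤n+o⇒m∸n≤o (m * P) (m * Q) mP≤mQ+DQ)
  regroup : ∀ e m p → e * (m * p) ≡ p * (m * e)
  regroup = solve-∀
  regroup′ : ∀ q c p d → q * c + p * (d * q) ≡ c * q + d * p * q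
  regroup′ = solve-∀

-- Read probabilistically, the hypotheses say Pr[hit i] = c i / P and Pr[hit i ∧ hit j] ≤ c i c j / (P Q)
-- for i ≢ j, where P / Q ≤ 1 + D / m; the conclusion is Var[#hits] ≤ (1 + D) 𝔼[#hits].
module SecondMoment {X : Set} (xs : List X) (m : ℕ)
  (hit : Fin m → X → ℕ) (hit≤1 : ∀ i x → hit i x ≤ 1) (c : Fin m → ℕ) (K₁ K₂ P Q D : ℕ)
  (∑-hit : ∀ i → ∑ xs (hit i) ≡ c i * K₁)
  (∑-hit-pair : ∀ i j → i ≢ j → ∑[ x ∈ xs ] (hit i x * hit j x) ≤ c i * c j * K₂)
  (c≤P : ∀ i → c i ≤ P)
  (length-xs : 1 ≤ m → length xs ≡ P * K₁)
  (K₁≡Q*K₂ : 2 ≤ m → K₁ ≡ Q * K₂)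
  (m*P≤m*Q+D*Q : m * P ≤ m * Q + D * Q) where

  #hits : X → ℕ
  #hits x = ∑[ i ∈ allFin m ] hit i x

  open Chebyshev xs #hits using (M; S₁; S₂)

  Fm : List (Fin m)
  Fm = allFin m
  C : ℕ
  C = ∑ Fm c

  offDiagonal : ℕ
  offDiagonal = ∑[ i ∈ Fm ] ∑[ j ∈ Fm ] (⟦ ¬? (j ≟ᶠ i) ⟧ * (c i * c j * K₂))

  S₁≡C*K₁ : S₁ ≡ C * K₁
  S₁≡C*K₁ = trans (∑-comm xs Fm (λ x i → hit i x)) (trans (∑-cong Fm ∑-hit) (∑-*ʳ Fm K₁ c))

  C≤m*P : C ≤ m * P
  C≤m*P = ≤-trans (∑-mono-≤ Fm c≤P) (≤-reflexive (trans (∑-const Fm P) (cong (_* P) (length-tabulate {n = m} id))))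

  ∑-hit-hit : ∀ i j (d : Dec (j ≡ i)) → ∑[ x ∈ xs ] (hit i x * hit j x) ≤ ⟦ d ⟧ * (c i * K₁) + ⟦ ¬? d ⟧ * (c i * c j * K₂)
  ∑-hit-hit i j (yes refl) = ≤-reflexive (trans (∑-cong xs (λ x → n≤1⇒n*n≡n (hit≤1 i x)))
                                           (trans (∑-hit i) (sym (trans (+-identityʳ _) (+-identityʳ _)))))
  ∑-hit-hit i j (no j≢i)   = ≤-trans (∑-hit-pair i j (j≢i ∘ sym)) (≤-reflexive (sym (+-identityʳ _)))

  S₂≤S₁+offDiagonal : S₂ ≤ S₁ + offDiagonal
  S₂≤S₁+offDiagonal = begin
    S₂
      ≡⟨ ∑-cong xs (λ x → trans (sym (∑-*ʳ Fm (#hits x) (λ i → hit i x))) (∑-cong Fm (λ i → sym (∑-*ˡ Fm (hit i x) (λ j → hit j x))))) ⟩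
    ∑[ x ∈ xs ] ∑[ i ∈ Fm ] ∑[ j ∈ Fm ] (hit i x * hit j x)
      ≡⟨ ∑-comm xs Fm _ ⟩
    ∑[ i ∈ Fm ] ∑[ x ∈ xs ] ∑[ j ∈ Fm ] (hit i x * hit j x)
      ≡⟨ ∑-cong Fm (λ i → ∑-comm xs Fm (λ x j → hit i x * hit j x)) ⟩
    ∑[ i ∈ Fm ] ∑[ j ∈ Fm ] ∑[ x ∈ xs ] (hit i x * hit j x)
      ≤⟨ ∑-mono-≤ Fm (λ i → ∑-mono-≤ Fm (λ j → ∑-hit-hit i j (j ≟ᶠ i))) ⟩
    ∑[ i ∈ Fm ] ∑[ j ∈ Fm ] (⟦ j ≟ᶠ i ⟧ * (c i * K₁) + ⟦ ¬? (j ≟ᶠ i) ⟧ * (c i * c j * K₂))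
      ≡⟨ ∑-cong Fm (λ i → trans (∑-+ Fm _ _) (cong (_+ _) (∑-allFin-δ m i (λ _ → c i * K₁)))) ⟩
    ∑[ i ∈ Fm ] (c i * K₁ + ∑[ j ∈ Fm ] (⟦ ¬? (j ≟ᶠ i) ⟧ * (c i * c j * K₂)))
      ≡⟨ ∑-+ Fm _ _ ⟩
    ∑[ i ∈ Fm ] (c i * K₁) + offDiagonal
      ≡⟨ cong (_+ offDiagonal) (trans (∑-*ʳ Fm K₁ c) (sym S₁≡C*K₁)) ⟩
    S₁ + offDiagonal
      ∎
    where open ≤-Reasoning

  offDiagonal≡0 : m ≤ 1 → offDiagonal ≡ 0
  offDiagonal≡0 m≤1 = begin
    offDiagonal                           ≡⟨ ∑-cong Fm (λ i → ∑-cong Fm (λ j → cong (_* (c i * c j * K₂)) (⟦⟧-no (¬? (j ≟ᶠ i)) (λ j≢i → j≢i (m≤1⇒Fin-irrelevant m≤1 j i))))) ⟩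
    ∑[ i ∈ Fm ] ∑[ j ∈ Fm ] 0             ≡⟨ ∑-cong Fm (λ i → trans (∑-const Fm 0) (*-zeroʳ (length Fm))) ⟩
    ∑[ i ∈ Fm ] 0                         ≡⟨ trans (∑-const Fm 0) (*-zeroʳ (length Fm)) ⟩
    0                                     ∎
    where open ≡-Reasoning

  offDiagonal≤C*C*K₂ : offDiagonal ≤ C * C * K₂
  offDiagonal≤C*C*K₂ = begin
    offDiagonal                               ≤⟨ ∑-mono-≤ Fm (λ i → ∑-mono-≤ Fm (λ j → ⟦⟧*≤ (¬? (j ≟ᶠ i)) (c i * c j * K₂))) ⟩
    ∑[ i ∈ Fm ] ∑[ j ∈ Fm ] (c i * c j * K₂)  ≡⟨ ∑-*-∑ Fm Fm c c K₂ ⟩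
    C * C * K₂                                ∎
    where open ≤-Reasoning

  M*offDiagonal≤ : M * offDiagonal ≤ S₁ * S₁ + D * (M * S₁)
  M*offDiagonal≤ with 2 ≤? m
  ... | no 2≰m = ≤-trans (≤-reflexive (trans (cong (M *_) (offDiagonal≡0 (≤-pred (≰⇒> 2≰m)))) (*-zeroʳ M))) z≤n
  ... | yes 2≤m = begin
    M * offDiagonal                      ≤⟨ *-monoʳ-≤ M offDiagonal≤C*C*K₂ ⟩
    M * (C * C * K₂)                     ≡⟨ cong (_* (C * C * K₂)) (length-xs (≤-trans (s≤s z≤n) 2≤m)) ⟩
    P * K₁ * (C * C * K₂)                ≡⟨ regroup P K₁ C K₂ ⟩
    K₁ * K₂ * C * (P * C)                ≤⟨ *-monoʳ-≤ (K₁ * K₂ * C) (P*C≤C*Q+D*P*Q m P Q D C C≤m*P m*P≤m*Q+D*Q) ⟩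
    K₁ * K₂ * C * (C * Q + D * P * Q)    ≡⟨ regroup′ K₁ K₂ C Q D P ⟩
    C * K₁ * (C * (Q * K₂)) + D * (P * K₁) * (C * (Q * K₂))
                                         ≡⟨ cong (λ k → C * K₁ * (C * k) + D * (P * K₁) * (C * k)) (K₁≡Q*K₂ 2≤m) ⟨
    C * K₁ * (C * K₁) + D * (P * K₁) * (C * K₁)
                                         ≡⟨ cong₂ (λ s k → s * s + D * k * s) (sym S₁≡C*K₁) (sym (length-xs (≤-trans (s≤s z≤n) 2≤m))) ⟩
    S₁ * S₁ + D * M * S₁                 ≡⟨ cong (S₁ * S₁ +_) (*-assoc D M S₁) ⟩
    S₁ * S₁ + D * (M * S₁)               ∎
    where
    open ≤-Reasoning
    regroup : ∀ p k c k₂ → p * k * (c * c * k₂) ≡ k * k₂ * c * (p * c)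
    regroup = solve-∀
    regroup′ : ∀ k₁ k₂ c q d p → k₁ * k₂ * c * (c * q + d * p * q) ≡ c * k₁ * (c * (q * k₂)) + d * (p * k₁) * (c * (q * k₂))
    regroup′ = solve-∀

  variance-bound : M * S₂ ≤ S₁ * S₁ + suc D * (M * S₁)
  variance-bound = begin
    M * S₂                                  ≤⟨ *-monoʳ-≤ M S₂≤S₁+offDiagonal ⟩
    M * (S₁ + offDiagonal)                  ≡⟨ *-distribˡ-+ M S₁ offDiagonal ⟩
    M * S₁ + M * offDiagonal                ≤⟨ +-monoʳ-≤ (M * S₁) M*offDiagonal≤ ⟩
    M * S₁ + (S₁ * S₁ + D * (M * S₁))       ≡⟨ regroup (M * S₁) (S₁ * S₁) D ⟩
    S₁ * S₁ + suc D * (M * S₁)              ∎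
    where
    open ≤-Reasoning
    regroup : ∀ x y d → x + (y + d * x) ≡ y + suc d * x
    regroup = solve-∀

-- Ratios of falling factorials

shiftConstant : ℕ → ℕ → ℕ
shiftConstant s zero    = 0
shiftConstant s (suc k) = shiftConstant s k + s + (s + k) * shiftConstant s k

-- The constant does not depend on y, so falling (y + s + k) k / falling (y + k) k = 1 + O(1 / y).
falling-shift : ∀ s k y → suc y * falling (y + s + k) k ≤ (suc y + shiftConstant s k) * falling (y + k) k
falling-shift s zero    y = ≤-reflexive (cong (_* 1) (sym (+-identityʳ (suc y))))
falling-shift s (suc k) y = begin
  suc y * falling (y + s + suc k) (suc k)
    ≡⟨ cong (λ t → suc y * falling t (suc k)) (+-suc (y + s) k) ⟩
  suc y * (suc (y + s + k) * falling (y + s + k) k)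
    ≡⟨ *-CS.x∙yz≈y∙xz (suc y) (suc (y + s + k)) _ ⟩
  suc (y + s + k) * (suc y * falling (y + s + k) k)
    ≤⟨ *-monoʳ-≤ (suc (y + s + k)) (falling-shift s k y) ⟩
  suc (y + s + k) * ((suc y + c) * F)
    ≡⟨ *-assoc (suc (y + s + k)) (suc y + c) F ⟨
  suc (y + s + k) * (suc y + c) * F
    ≤⟨ *-monoˡ-≤ F (m≤m+n (suc (y + s + k) * (suc y + c)) (y * (s + k) * c + k * c′)) ⟩
  (suc (y + s + k) * (suc y + c) + (y * (s + k) * c + k * c′)) * F
    ≡⟨ cong (_* F) (expand y s k c) ⟩
  (suc y + c′) * suc (y + k) * F
    ≡⟨ *-assoc (suc y + c′) (suc (y + k)) F ⟩
  (suc y + c′) * (suc (y + k) * F)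
    ≡⟨ cong (λ t → (suc y + c′) * falling t (suc k)) (+-suc y k) ⟨
  (suc y + c′) * falling (y + suc k) (suc k)
    ∎
  where
  open ≤-Reasoning
  c : ℕ
  c = shiftConstant s k
  c′ : ℕ
  c′ = shiftConstant s (suc k)
  F : ℕ
  F = falling (y + k) k
  expand : ∀ y s k a → suc (y + s + k) * (suc y + a) + (y * (s + k) * a + k * (a + s + (s + k) * a))
                       ≡ (suc y + (a + s + (s + k) * a)) * suc (y + k)
  expand = solve-∀

correlationConstant : ℕ → ℕ
correlationConstant f = (f + f) * shiftConstant f f

-- With y = n ∸ 2f, falling-shift bounds falling n f / falling (n ∸ f) f by 1 + shiftConstant f f / (y + 1),
-- and m ≤ 2f (y + 1) because m f ≤ n.
falling-ratio : ∀ f m n → 2 * f ≤ m * f → m * f ≤ n →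
  m * falling n f ≤ m * falling (n ∸ f) f + correlationConstant f * falling (n ∸ f) f
falling-ratio zero    m n _ _ = m≤m+n (m * 1) _
falling-ratio (suc g) m n 2f≤mf mf≤n = begin
  m * P                                       ≤⟨ *-monoʳ-≤ m (m≤n+m∸n P Q) ⟩
  m * (Q + (P ∸ Q))                           ≡⟨ *-distribˡ-+ m Q (P ∸ Q) ⟩
  m * Q + m * (P ∸ Q)                         ≤⟨ +-monoʳ-≤ (m * Q) (*-monoˡ-≤ (P ∸ Q) m≤2f[y+1]) ⟩
  m * Q + (f + f) * suc y * (P ∸ Q)           ≡⟨ cong (m * Q +_) (*-assoc (f + f) (suc y) (P ∸ Q)) ⟩
  m * Q + (f + f) * (suc y * (P ∸ Q))         ≤⟨ +-monoʳ-≤ (m * Q) (*-monoʳ-≤ (f + f) [y+1][P∸Q]≤AQ) ⟩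
  m * Q + (f + f) * (shiftConstant f f * Q)   ≡⟨ cong (m * Q +_) (*-assoc (f + f) (shiftConstant f f) Q) ⟨
  m * Q + correlationConstant f * Q           ∎
  where
  open ≤-Reasoning
  f = suc g
  P : ℕ
  P = falling n f
  Q : ℕ
  Q = falling (n ∸ f) f
  2f≤n : f + f ≤ n
  2f≤n = ≤-trans (≤-reflexive (cong (f +_) (sym (+-identityʳ f)))) (≤-trans 2f≤mf mf≤n)
  y : ℕ
  y = n ∸ (f + f)
  y+f+f≡n : y + f + f ≡ n
  y+f+f≡n = trans (+-assoc y f f) (trans (+-comm y (f + f)) (m+[n∸m]≡n 2f≤n))
  n∸f≡y+f : n ∸ f ≡ y + f
  n∸f≡y+f = trans (cong (_∸ f) (sym y+f+f≡n)) (m+n∸n≡m (y + f) f)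
  [y+1]P≤[y+1+A]Q : suc y * P ≤ (suc y + shiftConstant f f) * Q
  [y+1]P≤[y+1+A]Q = subst₂ (λ a b → suc y * falling a f ≤ (suc y + shiftConstant f f) * falling b f)
                            y+f+f≡n (sym n∸f≡y+f) (falling-shift f f y)
  [y+1][P∸Q]≤AQ : suc y * (P ∸ Q) ≤ shiftConstant f f * Q
  [y+1][P∸Q]≤AQ = ≤-trans (≤-reflexive (*-distribˡ-∸ (suc y) P Q))
    (m≤n+o⇒m∸n≤o (suc y * P) (suc y * Q) (≤-trans [y+1]P≤[y+1+A]Q (≤-reflexive (*-distribʳ-+ Q (suc y) (shiftConstant f f)))))
  m≤2f[y+1] : m ≤ (f + f) * suc y
  m≤2f[y+1] = begin
    m                  ≤⟨ m≤m*n m f ⟩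
    m * f              ≤⟨ mf≤n ⟩
    n                  ≡⟨ trans (sym y+f+f≡n) (reorder y f) ⟩
    f + f + y          ≤⟨ +-monoʳ-≤ (f + f) (m≤n*m y (f + f)) ⟩
    f + f + (f + f) * y ≡⟨ *-suc (f + f) y ⟨
    (f + f) * suc y    ∎
    where
    reorder : ∀ y f → y + f + f ≡ f + f + y
    reorder = solve-∀

toℚᵘ-ℕ→ℚ : ∀ k → ℚ.toℚᵘ (ℕ→ℚ k) ≡ ℚᵘ.mkℚᵘ (ℤ.+_ k) 0
toℚᵘ-ℕ→ℚ k = cong ℚ.toℚᵘ (ℚₚ.normalize-coprime (coprime-sym (1-coprimeTo k)))

ℕ→ℚ-+ : ∀ a b → ℕ→ℚ a ℚ.+ ℕ→ℚ b ≡ ℕ→ℚ (a + b)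
ℕ→ℚ-+ a b = ℚₚ.toℚᵘ-injective (ℚᵘₚ.≃-trans (ℚₚ.toℚᵘ-homo-+ (ℕ→ℚ a) (ℕ→ℚ b))
  (subst₂ (λ x y → (x ℚᵘ.+ y) ℚᵘ.≃ ℚ.toℚᵘ (ℕ→ℚ (a + b))) (sym (toℚᵘ-ℕ→ℚ a)) (sym (toℚᵘ-ℕ→ℚ b))
    (subst ((ℚᵘ.mkℚᵘ (ℤ.+_ a) 0 ℚᵘ.+ ℚᵘ.mkℚᵘ (ℤ.+_ b) 0) ℚᵘ.≃_) (sym (toℚᵘ-ℕ→ℚ (a + b)))
      (ℚᵘ.*≡* (trans (regroup (ℤ.+_ a) (ℤ.+_ b)) (cong (ℤ._* ℤ.1ℤ) (sym (ℤₚ.pos-+ a b))))))))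
  where
  regroup : ∀ x y → (x ℤ.* ℤ.1ℤ ℤ.+ y ℤ.* ℤ.1ℤ) ℤ.* ℤ.1ℤ ≡ (x ℤ.+ y) ℤ.* ℤ.1ℤ
  regroup = ℤ-Solver.solve-∀

ℕ→ℚ-* : ∀ a b → ℕ→ℚ a *ℚ ℕ→ℚ b ≡ ℕ→ℚ (a * b)
ℕ→ℚ-* a b = ℚₚ.toℚᵘ-injective (ℚᵘₚ.≃-trans (ℚₚ.toℚᵘ-homo-* (ℕ→ℚ a) (ℕ→ℚ b))
  (subst₂ (λ x y → (x ℚᵘ.* y) ℚᵘ.≃ ℚ.toℚᵘ (ℕ→ℚ (a * b))) (sym (toℚᵘ-ℕ→ℚ a)) (sym (toℚᵘ-ℕ→ℚ b))
    (subst ((ℚᵘ.mkℚᵘ (ℤ.+_ a) 0 ℚᵘ.* ℚᵘ.mkℚᵘ (ℤ.+_ b) 0) ℚᵘ.≃_) (sym (toℚᵘ-ℕ→ℚ (a * b)))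
      (ℚᵘ.*≡* (cong (ℤ._* ℤ.1ℤ) (sym (ℤₚ.pos-* a b)))))))

ℕ→ℚ-mono-≤ : ∀ {a b} → a ≤ b → ℕ→ℚ a ≤ℚ ℕ→ℚ b
ℕ→ℚ-mono-≤ {a} {b} a≤b = ℚₚ.toℚᵘ-cancel-≤ (subst₂ ℚᵘ._≤_ (sym (toℚᵘ-ℕ→ℚ a)) (sym (toℚᵘ-ℕ→ℚ b))
  (ℚᵘ.*≤* (subst₂ ℤ._≤_ (sym (ℤₚ.*-identityʳ (ℤ.+_ a))) (sym (ℤₚ.*-identityʳ (ℤ.+_ b))) (ℤ.+≤+ a≤b))))

ℕ→ℚ-mono-< : ∀ {a b} → a < b → ℕ→ℚ a <ℚ ℕ→ℚ b
ℕ→ℚ-mono-< {a} {b} a<b = ℚₚ.toℚᵘ-cancel-< (subst₂ ℚᵘ._<_ (sym (toℚᵘ-ℕ→ℚ a)) (sym (toℚᵘ-ℕ→ℚ b))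
  (ℚᵘ.*<* (subst₂ ℤ._<_ (sym (ℤₚ.*-identityʳ (ℤ.+_ a))) (sym (ℤₚ.*-identityʳ (ℤ.+_ b))) (ℤ.+<+ a<b))))

ℕ→ℚ-cancel-< : ∀ {a b} → ℕ→ℚ a <ℚ ℕ→ℚ b → a < b
ℕ→ℚ-cancel-< {a} {b} a<b with subst₂ ℚᵘ._<_ (toℚᵘ-ℕ→ℚ a) (toℚᵘ-ℕ→ℚ b) (ℚₚ.toℚᵘ-mono-< a<b)
... | ℚᵘ.*<* a*1<b*1 = ℤₚ.drop‿+<+ (subst₂ ℤ._<_ (ℤₚ.*-identityʳ (ℤ.+_ a)) (ℤₚ.*-identityʳ (ℤ.+_ b)) a*1<b*1)

ℕ→ℚ-nonNegative : ∀ k → ℚ.NonNegative (ℕ→ℚ k)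
ℕ→ℚ-nonNegative k = ℚ.nonNegative (ℕ→ℚ-mono-≤ {0} {k} z≤n)

∑-lower-bound : (γ : ℚ) (a : ℕ) (xs : List A) (b : A → ℕ) →
  (∀ x → γ *ℚ ℕ→ℚ a ≤ℚ ℕ→ℚ (b x)) → γ *ℚ ℕ→ℚ (length xs * a) ≤ℚ ℕ→ℚ (∑ xs b)
∑-lower-bound γ a []       b _ = ℚₚ.≤-reflexive (ℚₚ.*-zeroʳ γ)
∑-lower-bound γ a (x ∷ xs) b h = begin
  γ *ℚ ℕ→ℚ (a + length xs * a)                 ≡⟨ cong (γ *ℚ_) (ℕ→ℚ-+ a (length xs * a)) ⟨
  γ *ℚ (ℕ→ℚ a ℚ.+ ℕ→ℚ (length xs * a))         ≡⟨ ℚₚ.*-distribˡ-+ γ (ℕ→ℚ a) _ ⟩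
  γ *ℚ ℕ→ℚ a ℚ.+ γ *ℚ ℕ→ℚ (length xs * a)      ≤⟨ ℚₚ.+-mono-≤ (h x) (∑-lower-bound γ a xs b h) ⟩
  ℕ→ℚ (b x) ℚ.+ ℕ→ℚ (∑ xs b)                   ≡⟨ ℕ→ℚ-+ (b x) (∑ xs b) ⟩
  ℕ→ℚ (b x + ∑ xs b)                           ∎
  where open ℚₚ.≤-Reasoning

length-ordSubsets : ∀ n f → length (ordSubsets n f) ≡ falling n f
length-ordSubsets n f = begin
  length (ordSubsets n f)                                    ≡⟨ length-filter≡∑⟦⟧ isOrdered? (allTuples (allFin n) f) ⟩
  ∑[ v ∈ allTuples (allFin n) f ] ⟦ isOrdered? v ⟧            ≡⟨ ∑-cong (allTuples (allFin n) f) (λ v →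
                                                                  ⟦⟧-cong (isOrdered? v) (orderedAvoiding? [] v) (λ ov → ov , All.tabulate (λ _ ())) proj₁) ⟩
  ∑[ v ∈ allTuples (allFin n) f ] ⟦ orderedAvoiding? [] v ⟧   ≡⟨ ∑-orderedAvoiding f [] [] ⟩
  falling n f                                                ∎
  where open ≡-Reasoning

concentrationConstant : ℕ → ℕ
concentrationConstant f = 4 * suc (correlationConstant f)

module Concentration (f m n : ℕ) (γ : ℚ) (γ>0 : 0ℚ <ℚ γ) (2f≤mf : 2 * f ≤ m * f) (mf≤n : m * f ≤ n)
  (F : Fin m → Vec (Fin n) f → Bool) (γnᶠ≤|Fᵢ| : ∀ i → γ *ℚ ℕ→ℚ (n ^ f) ≤ℚ ℕ→ℚ (card (F i))) where

  E₁ E₂ : ℕ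
  E₁ = extensions₁ {n} {f} m
  E₂ = extensions₂ {n} {f} m

  inF : Fin m → Vec (Fin n) f → ℕ
  inF i x = ⟦ F i x ≟ᵇ true ⟧

  hit : Fin m → Vec (Vec (Fin n) f) m → ℕ
  hit i ω = inF i (lookup ω i)

  |F|≡∑ : ∀ i → card (F i) ≡ ∑ (ordSubsets n f) (inF i)
  |F|≡∑ i = length-filter≡∑⟦⟧ (λ x → F i x ≟ᵇ true) (ordSubsets n f)

  |F|≤falling : ∀ i → card (F i) ≤ falling n f
  |F|≤falling i = ≤-trans (length-filter (λ x → F i x ≟ᵇ true) (ordSubsets n f)) (≤-reflexive (length-ordSubsets n f))

  length-Ω≡ : 1 ≤ m → length (Ω n f m) ≡ falling n f * E₁
  length-Ω≡ 1≤m = trans (length-Ω m) (trans (cong (falling n) f*m≡f+f*[m∸1]) (falling-+ n f (f * (m ∸ 1))))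
    where
    f*m≡f+f*[m∸1] : f * m ≡ f + f * (m ∸ 1)
    f*m≡f+f*[m∸1] = trans (cong (f *_) (sym (m+[n∸m]≡n 1≤m))) (*-suc f (m ∸ 1))

  E₁≡ : 2 ≤ m → E₁ ≡ falling (n ∸ f) f * E₂
  E₁≡ 2≤m = begin
    falling (n ∸ f) (f * (m ∸ 1))                           ≡⟨ cong (falling (n ∸ f)) f*[m∸1]≡f+f*[m∸2] ⟩
    falling (n ∸ f) (f + f * (m ∸ 2))                       ≡⟨ falling-+ (n ∸ f) f (f * (m ∸ 2)) ⟩
    falling (n ∸ f) f * falling (n ∸ f ∸ f) (f * (m ∸ 2))   ≡⟨ cong (λ k → falling (n ∸ f) f * falling k (f * (m ∸ 2))) (∸-+-assoc n f f) ⟩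
    falling (n ∸ f) f * E₂                                  ∎
    where
    open ≡-Reasoning
    f*[m∸1]≡f+f*[m∸2] : f * (m ∸ 1) ≡ f + f * (m ∸ 2)
    f*[m∸1]≡f+f*[m∸2] = trans (cong (λ k → f * (k ∸ 1)) (sym (m+[n∸m]≡n 2≤m))) (*-suc f (m ∸ 2))

  open SecondMoment (Ω n f m) m hit (λ i ω → ⟦⟧≤1 (F i (lookup ω i) ≟ᵇ true)) (λ i → card (F i))
    E₁ E₂ (falling n f) (falling (n ∸ f) f) (correlationConstant f)
    (λ i → trans (∑Ω-lookup i (inF i)) (cong (_* E₁) (sym (|F|≡∑ i))))
    (λ i j i≢j → ≤-trans (∑Ω-lookup-pair i j i≢j (inF i) (inF j)) (≤-reflexive (cong₂ (λ a b → a * b * E₂) (sym (|F|≡∑ i)) (sym (|F|≡∑ j)))))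
    |F|≤falling length-Ω≡ E₁≡ (falling-ratio f m n 2f≤mf mf≤n)
    using (#hits; S₁≡C*K₁; variance-bound)
  open Chebyshev (Ω n f m) #hits using (M; S₁; chebyshev)

  γ-nonNegative : ℚ.NonNegative γ
  γ-nonNegative = ℚₚ.pos⇒nonNeg γ {{ℚ.positive γ>0}}

  γM≤|Fᵢ|E₁ : 1 ≤ m → ∀ i → γ *ℚ ℕ→ℚ M ≤ℚ ℕ→ℚ (card (F i) * E₁)
  γM≤|Fᵢ|E₁ 1≤m i = begin
    γ *ℚ ℕ→ℚ M                             ≡⟨ cong (λ k → γ *ℚ ℕ→ℚ k) (length-Ω≡ 1≤m) ⟩
    γ *ℚ ℕ→ℚ (falling n f * E₁)            ≡⟨ cong (γ *ℚ_) (ℕ→ℚ-* (falling n f) E₁) ⟨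
    γ *ℚ (ℕ→ℚ (falling n f) *ℚ ℕ→ℚ E₁)     ≡⟨ ℚₚ.*-assoc γ (ℕ→ℚ (falling n f)) (ℕ→ℚ E₁) ⟨
    γ *ℚ ℕ→ℚ (falling n f) *ℚ ℕ→ℚ E₁       ≤⟨ ℚₚ.*-monoʳ-≤-nonNeg (ℕ→ℚ E₁) {{ℕ→ℚ-nonNegative E₁}}
                                                (ℚₚ.*-monoˡ-≤-nonNeg γ {{γ-nonNegative}} (ℕ→ℚ-mono-≤ (falling≤^ n f))) ⟩
    γ *ℚ ℕ→ℚ (n ^ f) *ℚ ℕ→ℚ E₁             ≤⟨ ℚₚ.*-monoʳ-≤-nonNeg (ℕ→ℚ E₁) {{ℕ→ℚ-nonNegative E₁}} (γnᶠ≤|Fᵢ| i) ⟩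
    ℕ→ℚ (card (F i)) *ℚ ℕ→ℚ E₁             ≡⟨ ℕ→ℚ-* (card (F i)) E₁ ⟩
    ℕ→ℚ (card (F i) * E₁)                  ∎
    where open ℚₚ.≤-Reasoning

  γmM≤S₁ : 1 ≤ m → γ *ℚ ℕ→ℚ (m * M) ≤ℚ ℕ→ℚ S₁
  γmM≤S₁ 1≤m = begin
    γ *ℚ ℕ→ℚ (m * M)                        ≡⟨ cong (λ k → γ *ℚ ℕ→ℚ (k * M)) (length-tabulate {n = m} id) ⟨
    γ *ℚ ℕ→ℚ (length (allFin m) * M)        ≤⟨ ∑-lower-bound γ M (allFin m) (λ i → card (F i) * E₁) (γM≤|Fᵢ|E₁ 1≤m) ⟩
    ℕ→ℚ (∑[ i ∈ allFin m ] (card (F i) * E₁)) ≡⟨ cong ℕ→ℚ (trans (∑-*ʳ (allFin m) E₁ (λ i → card (F i))) (sym S₁≡C*K₁)) ⟩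
    ℕ→ℚ S₁                                  ∎
    where open ℚₚ.≤-Reasoning

  Low : Vec (Vec (Fin n) f) m → Set
  Low ω = ℕ→ℚ (2 * countHits F ω) <ℚ γ *ℚ ℕ→ℚ m

  low? : ∀ ω → Dec (Low ω)
  low? ω = ℕ→ℚ (2 * countHits F ω) <? γ *ℚ ℕ→ℚ m

  low⇒below-half-mean : 1 ≤ m → ℚ.Positive (ℕ→ℚ M) → ∀ ω → Low ω → 2 * (M * #hits ω) < S₁
  low⇒below-half-mean 1≤m M>0 ω low = subst (_< S₁) (regroup (#hits ω) M) (ℕ→ℚ-cancel-< (begin-strict
    ℕ→ℚ (2 * #hits ω * M)                    ≡⟨ ℕ→ℚ-* (2 * #hits ω) M ⟨
    ℕ→ℚ (2 * #hits ω) *ℚ ℕ→ℚ M               <⟨ ℚₚ.*-monoˡ-<-pos (ℕ→ℚ M) {{M>0}} (subst (λ k → ℕ→ℚ (2 * k) <ℚ γ *ℚ ℕ→ℚ m) countHits≡#hits low) ⟩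
    γ *ℚ ℕ→ℚ m *ℚ ℕ→ℚ M                      ≡⟨ trans (ℚₚ.*-assoc γ (ℕ→ℚ m) (ℕ→ℚ M)) (cong (γ *ℚ_) (ℕ→ℚ-* m M)) ⟩
    γ *ℚ ℕ→ℚ (m * M)                         ≤⟨ γmM≤S₁ 1≤m ⟩
    ℕ→ℚ S₁                                   ∎))
    where
    open ℚₚ.≤-Reasoning
    countHits≡#hits : countHits F ω ≡ #hits ω
    countHits≡#hits = length-filter≡∑⟦⟧ (λ i → F i (lookup ω i) ≟ᵇ true) (allFin m)
    regroup : ∀ x y → 2 * x * y ≡ 2 * (y * x)
    regroup x y = trans (*-assoc 2 x y) (cong (2 *_) (*-comm x y))

  #Low : ℕ
  #Low = length (filter low? (Ω n f m))

  Cf : ℕ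
  Cf = concentrationConstant f

  Goal : Set
  Goal = ℕ→ℚ #Low *ℚ (γ *ℚ ℕ→ℚ m) ≤ℚ ℕ→ℚ Cf *ℚ ℕ→ℚ M

  0≤Cf*M : 0ℚ ≤ℚ ℕ→ℚ Cf *ℚ ℕ→ℚ M
  0≤Cf*M = subst (0ℚ ≤ℚ_) (sym (ℕ→ℚ-* Cf M)) (ℕ→ℚ-mono-≤ {0} {Cf * M} z≤n)

  bound-m≡0 : m ≡ 0 → Goal
  bound-m≡0 m≡0 = ℚₚ.≤-trans (ℚₚ.≤-reflexive LHS≡0) 0≤Cf*M
    where
    LHS≡0 : ℕ→ℚ #Low *ℚ (γ *ℚ ℕ→ℚ m) ≡ 0ℚ
    LHS≡0 = trans (cong (λ k → ℕ→ℚ #Low *ℚ (γ *ℚ ℕ→ℚ k)) m≡0)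
                  (trans (cong (ℕ→ℚ #Low *ℚ_) (ℚₚ.*-zeroʳ γ)) (ℚₚ.*-zeroʳ (ℕ→ℚ #Low)))

  bound-M≡0 : M ≡ 0 → Goal
  bound-M≡0 M≡0 = ℚₚ.≤-trans (ℚₚ.≤-reflexive LHS≡0) 0≤Cf*M
    where
    #Low≡0 : #Low ≡ 0
    #Low≡0 = n≤0⇒n≡0 (≤-trans (length-filter low? (Ω n f m)) (≤-reflexive M≡0))
    LHS≡0 : ℕ→ℚ #Low *ℚ (γ *ℚ ℕ→ℚ m) ≡ 0ℚ
    LHS≡0 = trans (cong (λ k → ℕ→ℚ k *ℚ (γ *ℚ ℕ→ℚ m)) #Low≡0) (ℚₚ.*-zeroˡ (γ *ℚ ℕ→ℚ m))

  bound-main : 1 ≤ m → 1 ≤ M → Goal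
  bound-main 1≤m 1≤M = ℚₚ.*-cancelʳ-≤-pos (ℕ→ℚ M) {{M>0}} (begin
    ℕ→ℚ #Low *ℚ (γ *ℚ ℕ→ℚ m) *ℚ ℕ→ℚ M    ≡⟨ trans (ℚₚ.*-assoc (ℕ→ℚ #Low) _ _)
                                              (cong (ℕ→ℚ #Low *ℚ_) (trans (ℚₚ.*-assoc γ (ℕ→ℚ m) (ℕ→ℚ M)) (cong (γ *ℚ_) (ℕ→ℚ-* m M)))) ⟩
    ℕ→ℚ #Low *ℚ (γ *ℚ ℕ→ℚ (m * M))       ≤⟨ ℚₚ.*-monoˡ-≤-nonNeg (ℕ→ℚ #Low) {{ℕ→ℚ-nonNegative #Low}} (γmM≤S₁ 1≤m) ⟩
    ℕ→ℚ #Low *ℚ ℕ→ℚ S₁                   ≡⟨ ℕ→ℚ-* #Low S₁ ⟩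
    ℕ→ℚ (#Low * S₁)                      ≤⟨ ℕ→ℚ-mono-≤ {#Low * S₁} {Cf * (M * M)} #Low*S₁≤Cf*M² ⟩
    ℕ→ℚ (Cf * (M * M))                   ≡⟨ cong ℕ→ℚ (*-assoc Cf M M) ⟨
    ℕ→ℚ (Cf * M * M)                     ≡⟨ ℕ→ℚ-* (Cf * M) M ⟨
    ℕ→ℚ (Cf * M) *ℚ ℕ→ℚ M                ≡⟨ cong (_*ℚ ℕ→ℚ M) (ℕ→ℚ-* Cf M) ⟨
    ℕ→ℚ Cf *ℚ ℕ→ℚ M *ℚ ℕ→ℚ M             ∎)
    where
    open ℚₚ.≤-Reasoning
    M>0 : ℚ.Positive (ℕ→ℚ M)
    M>0 = ℚ.positive (ℕ→ℚ-mono-< {0} {M} 1≤M)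
    #Low*S₁≤Cf*M² : #Low * S₁ ≤ Cf * (M * M)
    #Low*S₁≤Cf*M² = ≤-trans (≤-reflexive (cong (_* S₁) (length-filter≡∑⟦⟧ low? (Ω n f m))))
                            (chebyshev (suc (correlationConstant f)) variance-bound low? (low⇒below-half-mean 1≤m M>0))

  bound : Goal
  bound = by-cases (1 ≤? m) (1 ≤? M)
    where
    by-cases : Dec (1 ≤ m) → Dec (1 ≤ M) → Goal
    by-cases (no 1≰m)  _         = bound-m≡0 (n<1⇒n≡0 (≰⇒> 1≰m))
    by-cases (yes _)   (no 1≰M)  = bound-M≡0 (n<1⇒n≡0 (≰⇒> 1≰M))
    by-cases (yes 1≤m) (yes 1≤M) = bound-main 1≤m 1≤M

lemma4p4 : (f : ℕ) → ∃ λ (C : ℚ) →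
    (m n : ℕ) (γ : ℚ) → 0ℚ <ℚ γ → 2 * f ≤ m * f → m * f ≤ n →
    (F : Fin m → Vec (Fin n) f → Bool) →
    (∀ i → γ *ℚ ℕ→ℚ (n ^ f) ≤ℚ ℕ→ℚ (card (F i))) →
    ℕ→ℚ (length (filter (λ ω → ℕ→ℚ (2 * countHits F ω) <? γ *ℚ ℕ→ℚ m) (Ω n f m)))
    *ℚ (γ *ℚ ℕ→ℚ m)
    ≤ℚ C *ℚ ℕ→ℚ (length (Ω n f m))
lemma4p4 f = ℕ→ℚ (concentrationConstant f) , Concentration.bound f
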